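{- The following six mesh patterns $(12,R)$ are pairwise equidistributed, where $R$ ranges over: $\{(1,2),(0,1),(1,1),(2,1),(0,0)\}$, $\{(1,2),(2,2),(0,1),(1,1),(1,0)\}$, $\{(2,2),(0,1),(1,1),(2,1),(1,0)\}$, $\{(1,2),(1,1),(2,1),(0,0),(1,0)\}$, $\{(2,2),(0,1),(1,1),(2,1),(0,0)\}$, $\{(1,2),(2,2),(1,1),(0,0),(1,0)\}$.
   Context: For $R\subseteq\{0,1,2\}^2$ and $\pi=\pi_1\cdots\pi_n\in S_n$, an occurrence of the mesh pattern $(12,R)$ in $\pi$ is a pair of positions $i_1<i_2$ with $\pi_{i_1}<\pi_{i_2}$ such that, setting $x_0=0,x_1=i_1,x_2=i_2,x_3=n+1$ and $y_0=0,y_1=\pi_{i_1},y_2=\pi_{i_2},y_3=n+1$, for every $(a,b)\in R$ there is no index $k$ with $x_a<k<x_{a+1}$ and $y_b<\pi_k<y_{b+1}$. $s_{n,k}(p)$ is the number of $\pi\in S_n$ with exactly $k$ occurrences of $p$; $p_1,p_2$ are equidistributed if $s_{n,k}(p_1)=s_{n,k}(p_2)$ for all $n,k\ge 0$. -}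

module Defs where

open import Data.Nat using (ℕ; zero; suc; _<ᵇ_; _≡ᵇ_)
open import Data.Bool using (Bool; true; false; _∧_; _∨_; not)
open import Data.Fin as Fin using (Fin; toℕ; inject₁; #_)
open import Data.Product using (_×_; _,_)
open import Data.List using (List; []; _∷_; map; concatMap; filterᵇ; length; allFin)
open import Data.Vec using (Vec; []; _∷_; lookup)
open import Relation.Binary.PropositionalEquality using (_≡_)

allᵇ : {A : Set} → (A → Bool) → List A → Bool
allᵇ p [] = true
allᵇ p (x ∷ xs) = p x ∧ allᵇ p xs

anyᵇ : {A : Set} → (A → Bool) → List A → Bool
anyᵇ p [] = false
anyᵇ p (x ∷ xs) = p x ∨ anyᵇ p xs

-- A mesh pattern (12, R) is determined by R ⊆ {0,1,2}², given as a list of boxes (a , b).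
MeshR : Set
MeshR = List (Fin 3 × Fin 3)

-- A permutation π ∈ S_n is represented in one-line notation as a vector of
-- length n with entries in Fin n (entry i holds π_{i+1} - 1) that is injective.
isPerm : ∀ {n} → Vec (Fin n) n → Bool
isPerm {n} π =
  allᵇ (λ i → allᵇ (λ j → (toℕ i ≡ᵇ toℕ j) ∨ not (toℕ (lookup π i) ≡ᵇ toℕ (lookup π j)))
                   (allFin n))
       (allFin n)

allVecs : (n m : ℕ) → List (Vec (Fin n) m)
allVecs n zero = [] ∷ []
allVecs n (suc m) = concatMap (λ x → map (x ∷_) (allVecs n m)) (allFin n)

perms : (n : ℕ) → List (Vec (Fin n) n)
perms n = filterᵇ isPerm (allVecs n n)

pos : ∀ {n} → Fin n → ℕ
pos i = suc (toℕ i)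

val : ∀ {n} → Vec (Fin n) n → Fin n → ℕ
val π i = suc (toℕ (lookup π i))

bounds : ℕ → ℕ → ℕ → Fin 4 → ℕ
bounds n u v Fin.zero = 0
bounds n u v (Fin.suc Fin.zero) = u
bounds n u v (Fin.suc (Fin.suc Fin.zero)) = v
bounds n u v (Fin.suc (Fin.suc (Fin.suc Fin.zero))) = suc n

boxEmpty : ∀ {n} → Vec (Fin n) n → (Fin 4 → ℕ) → (Fin 4 → ℕ) → Fin 3 × Fin 3 → Bool
boxEmpty {n} π xs ys (a , b) =
  not (anyᵇ (λ k → (xs (inject₁ a) <ᵇ pos k) ∧ (pos k <ᵇ xs (Fin.suc a))
                   ∧ (ys (inject₁ b) <ᵇ val π k) ∧ (val π k <ᵇ ys (Fin.suc b)))
            (allFin n))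

isOcc : ∀ {n} → MeshR → Vec (Fin n) n → Fin n → Fin n → Bool
isOcc {n} R π i₁ i₂ =
  (pos i₁ <ᵇ pos i₂) ∧ (val π i₁ <ᵇ val π i₂)
  ∧ allᵇ (boxEmpty π (bounds n (pos i₁) (pos i₂)) (bounds n (val π i₁) (val π i₂))) R

occ : ∀ {n} → MeshR → Vec (Fin n) n → ℕ
occ {n} R π = length (concatMap (λ i → filterᵇ (isOcc R π i) (allFin n)) (allFin n))

s : MeshR → ℕ → ℕ → ℕ
s R n k = length (filterᵇ (λ π → occ R π ≡ᵇ k) (perms n))

Equidistributed : MeshR → MeshR → Set
Equidistributed R₁ R₂ = ∀ n k → s R₁ n k ≡ s R₂ n k

R1 : MeshR
R1 = (# 1 , # 2) ∷ (# 0 , # 1) ∷ (# 1 , # 1) ∷ (# 2 , # 1) ∷ (# 0 , # 0) ∷ []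

R2 : MeshR
R2 = (# 1 , # 2) ∷ (# 2 , # 2) ∷ (# 0 , # 1) ∷ (# 1 , # 1) ∷ (# 1 , # 0) ∷ []

R3 : MeshR
R3 = (# 2 , # 2) ∷ (# 0 , # 1) ∷ (# 1 , # 1) ∷ (# 2 , # 1) ∷ (# 1 , # 0) ∷ []

R4 : MeshR
R4 = (# 1 , # 2) ∷ (# 1 , # 1) ∷ (# 2 , # 1) ∷ (# 0 , # 0) ∷ (# 1 , # 0) ∷ []

R5 : MeshR
R5 = (# 2 , # 2) ∷ (# 0 , # 1) ∷ (# 1 , # 1) ∷ (# 2 , # 1) ∷ (# 0 , # 0) ∷ []

R6 : MeshR
R6 = (# 1 , # 2) ∷ (# 2 , # 2) ∷ (# 1 , # 1) ∷ (# 0 , # 0) ∷ (# 1 , # 0) ∷ []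

theRs : List MeshR
theRs = R1 ∷ R2 ∷ R3 ∷ R4 ∷ R5 ∷ R6 ∷ []

{-# OPTIONS --safe #-}
-- Removing the smallest entry of a permutation of [n], recording its position and recursing encodes
-- permutations as codes (x₁, …, xₙ) with xₖ ≤ n − k; removing instead the first, the largest or the
-- last entry gives three more encodings. For each of the six shadings an occurrence of (12, R) that
-- involves the removed entry must pair it with the entry removed next, so in a suitable encoding the
-- number of occurrences becomes a statistic of the code. For R1, …, R4 it is repeatCount, the number
-- of k with xₖ = xₖ₊₁ and xₖ below all earlier entries (this comes from the shaded corner box). For
-- R5 and R6 it is topCount, which asks instead that xₖ₊₁ be maximal and xₖ ≤ xₖ₊₁. Whenever xₖ is
-- below all earlier entries, the involution reflectCode reflects xₖ₊₁ in the interval [xₖ, n − k − 1].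
-- This swaps "xₖ₊₁ = xₖ" with "xₖ₊₁ maximal", so it carries one statistic to the other.

module Submission where

open import Defs
open import Data.List.Membership.Propositional using (_∈_)

open import Data.Bool using (Bool; true; false; _∧_; _∨_; not)
open import Data.Bool.Properties using (T-≡; ∧-assoc; ∧-zeroʳ; ∧-identityʳ; ∨-assoc; ∨-comm)
open import Data.Empty using (⊥; ⊥-elim)
open import Data.Fin as Fin using (Fin; toℕ; fromℕ; fromℕ<; punchIn; punchOut; opposite; inject₁; #_)
open import Data.Fin.Patterns using (0F; 1F; 2F)
open import Data.Fin.Properties as Fin using (toℕ-injective; toℕ<n; toℕ-fromℕ; toℕ-fromℕ<; opposite-prop; opposite-involutive; punchInᵢ≢i; punchIn-injective; punchIn-punchOut; punchOut-punchIn; punchOut-injective; pigeonhole; any?)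
open import Data.List using (List; []; _∷_; _++_; map; concatMap; filterᵇ; length; allFin; tabulate)
open import Data.List.Relation.Unary.Any using (here; there)
open import Data.Nat using (ℕ; zero; suc; _+_; _*_; _∸_; _⊓_; _≤_; _<_; z≤n; s≤s; _<ᵇ_; _≤ᵇ_; _≡ᵇ_)
open import Data.Nat.Properties
open import Data.Product using (Σ; ∃; _×_; _,_; proj₁; proj₂)
open import Data.Product.Properties as Product using ()
open import Data.Sum using (_⊎_; inj₁; inj₂)
open import Data.Unit using (⊤; tt)
open import Data.Vec as Vec using (Vec; []; _∷_; lookup; insertAt; removeAt)
open import Data.Vec.Properties as Vec using (insertAt-lookup; insertAt-punchIn; removeAt-insertAt; insertAt-removeAt; removeAt-punchOut; lookup-map; map-∘; map-cong; map-id; tabulate∘lookup; tabulate-cong)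
open import Function using (_∘_; Equivalence)
open import Relation.Binary.Definitions using (DecidableEquality; tri<; tri≈; tri>)
open import Relation.Binary.PropositionalEquality
open import Relation.Nullary using (yes; no)
open import Relation.Nullary.Decidable using (does)

open import Algebra.Properties.CommutativeMonoid.Sum +-0-commutativeMonoid
  using (sum-syntax; sum-remove; ∑-distrib-+; sum-cong-≗; sum-replicate-zero)

𝟙 : Bool → ℕ
𝟙 true = 1
𝟙 false = 0

module _ {m n : ℕ} where

  <⇒<ᵇ≡true : m < n → (m <ᵇ n) ≡ true
  <⇒<ᵇ≡true p = Equivalence.to T-≡ (<⇒<ᵇ p)

  <ᵇ≡true⇒< : (m <ᵇ n) ≡ true → m < n
  <ᵇ≡true⇒< e = <ᵇ⇒< m n (Equivalence.from T-≡ e)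

  ≥⇒<ᵇ≡false : n ≤ m → (m <ᵇ n) ≡ false
  ≥⇒<ᵇ≡false p with m <ᵇ n in e
  ... | false = refl
  ... | true = ⊥-elim (<⇒≱ (<ᵇ≡true⇒< e) p)

  ≤⇒≤ᵇ≡true : m ≤ n → (m ≤ᵇ n) ≡ true
  ≤⇒≤ᵇ≡true p = Equivalence.to T-≡ (≤⇒≤ᵇ p)

  ≤ᵇ≡true⇒≤ : (m ≤ᵇ n) ≡ true → m ≤ n
  ≤ᵇ≡true⇒≤ e = ≤ᵇ⇒≤ m n (Equivalence.from T-≡ e)

  >⇒≤ᵇ≡false : n < m → (m ≤ᵇ n) ≡ false
  >⇒≤ᵇ≡false p with m ≤ᵇ n in e
  ... | false = refl
  ... | true = ⊥-elim (<⇒≱ p (≤ᵇ≡true⇒≤ e))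

  ≡⇒≡ᵇ≡true : m ≡ n → (m ≡ᵇ n) ≡ true
  ≡⇒≡ᵇ≡true p = Equivalence.to T-≡ (≡⇒≡ᵇ m n p)

  ≡ᵇ≡true⇒≡ : (m ≡ᵇ n) ≡ true → m ≡ n
  ≡ᵇ≡true⇒≡ e = ≡ᵇ⇒≡ m n (Equivalence.from T-≡ e)

  ≢⇒≡ᵇ≡false : m ≢ n → (m ≡ᵇ n) ≡ false
  ≢⇒≡ᵇ≡false p with m ≡ᵇ n in e
  ... | false = refl
  ... | true = ⊥-elim (p (≡ᵇ≡true⇒≡ e))

n<ᵇn≡false : ∀ n → (n <ᵇ n) ≡ false
n<ᵇn≡false n = ≥⇒<ᵇ≡false {n} {n} ≤-refl

true≢false : true ≢ false
true≢false ()

Bool-ext : ∀ {a b} → (a ≡ true → b ≡ true) → (b ≡ true → a ≡ true) → a ≡ b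
Bool-ext {false} {false} f g = refl
Bool-ext {false} {true} f g = g refl
Bool-ext {true} {b} f g = sym (f refl)

∧-true : ∀ {a b} → a ≡ true → b ≡ true → a ∧ b ≡ true
∧-true refl refl = refl

∧-falseʳ : ∀ a {b} → b ≡ false → a ∧ b ≡ false
∧-falseʳ a refl = ∧-zeroʳ a

∧-trueˡ : ∀ {a b} → a ∧ b ≡ true → a ≡ true
∧-trueˡ {true} _ = refl

∧-trueʳ : ∀ a {b} → a ∧ b ≡ true → b ≡ true
∧-trueʳ true e = e

allᵇ-cong : ∀ {A : Set} (xs : List A) {f g : A → Bool} → (∀ x → f x ≡ g x) → allᵇ f xs ≡ allᵇ g xs
allᵇ-cong [] e = refl
allᵇ-cong (x ∷ xs) e = cong₂ _∧_ (e x) (allᵇ-cong xs e)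

allᵇ-∈ : ∀ {A : Set} (f : A → Bool) (xs : List A) {x} → allᵇ f xs ≡ true → x ∈ xs → f x ≡ true
allᵇ-∈ f (y ∷ xs) e (here refl) = ∧-trueˡ e
allᵇ-∈ f (y ∷ xs) e (there m) = allᵇ-∈ f xs (∧-trueʳ (f y) e) m

allᵇ-tabulate : ∀ {A : Set} n (p : A → Bool) (f : Fin n → A) → allᵇ p (tabulate f) ≡ true → ∀ i → p (f i) ≡ true
allᵇ-tabulate (suc n) p f e Fin.zero = ∧-trueˡ e
allᵇ-tabulate (suc n) p f e (Fin.suc i) = allᵇ-tabulate n p (f ∘ Fin.suc) (∧-trueʳ (p (f Fin.zero)) e) i

tabulate-allᵇ : ∀ {A : Set} n (p : A → Bool) (f : Fin n → A) → (∀ i → p (f i) ≡ true) → allᵇ p (tabulate f) ≡ true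
tabulate-allᵇ zero p f e = refl
tabulate-allᵇ (suc n) p f e = ∧-true (e Fin.zero) (tabulate-allᵇ n p (f ∘ Fin.suc) (e ∘ Fin.suc))

sumL : {A : Set} → List A → (A → ℕ) → ℕ
sumL [] h = 0
sumL (x ∷ xs) h = h x + sumL xs h

infix 5 sumL
syntax sumL xs (λ x → e) = ∑[ x ∈ xs ] e

module _ {A : Set} where

  length-filterᵇ : (p : A → Bool) (xs : List A) → length (filterᵇ p xs) ≡ ∑[ x ∈ xs ] 𝟙 (p x)
  length-filterᵇ p [] = refl
  length-filterᵇ p (x ∷ xs) with p x
  ... | true = cong suc (length-filterᵇ p xs)
  ... | false = length-filterᵇ p xs

  sumL-filterᵇ : (p : A → Bool) (xs : List A) (h : A → ℕ) → sumL (filterᵇ p xs) h ≡ ∑[ x ∈ xs ] 𝟙 (p x) * h x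
  sumL-filterᵇ p [] h = refl
  sumL-filterᵇ p (x ∷ xs) h with p x
  ... | true = cong₂ _+_ (sym (+-identityʳ (h x))) (sumL-filterᵇ p xs h)
  ... | false = sumL-filterᵇ p xs h

  sumL-++ : (xs ys : List A) (h : A → ℕ) → sumL (xs ++ ys) h ≡ sumL xs h + sumL ys h
  sumL-++ [] ys h = refl
  sumL-++ (x ∷ xs) ys h = trans (cong (h x +_) (sumL-++ xs ys h)) (sym (+-assoc (h x) _ _))

  sumL-cong : (xs : List A) {h h′ : A → ℕ} → (∀ x → h x ≡ h′ x) → sumL xs h ≡ sumL xs h′
  sumL-cong [] e = refl
  sumL-cong (x ∷ xs) e = cong₂ _+_ (e x) (sumL-cong xs e)

  sumL-+ : (xs : List A) (h h′ : A → ℕ) → ∑[ x ∈ xs ] (h x + h′ x) ≡ sumL xs h + sumL xs h′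
  sumL-+ [] h h′ = refl
  sumL-+ (x ∷ xs) h h′ rewrite sumL-+ xs h h′ = +-assoc-comm (h x) (h′ x) (sumL xs h) (sumL xs h′)
    where
    +-assoc-comm : ∀ a b c d → (a + b) + (c + d) ≡ (a + c) + (b + d)
    +-assoc-comm a b c d = begin
      (a + b) + (c + d)  ≡⟨ +-assoc a b (c + d) ⟩
      a + (b + (c + d))  ≡⟨ cong (a +_) (+-comm b (c + d)) ⟩
      a + ((c + d) + b)  ≡⟨ cong (a +_) (+-assoc c d b) ⟩
      a + (c + (d + b))  ≡⟨ cong (λ t → a + (c + t)) (+-comm d b) ⟩
      a + (c + (b + d))  ≡⟨ +-assoc a c (b + d) ⟨
      (a + c) + (b + d)  ∎
      where open ≡-Reasoning

  sumL-*ˡ : (xs : List A) (c : ℕ) (h : A → ℕ) → ∑[ x ∈ xs ] c * h x ≡ c * sumL xs h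
  sumL-*ˡ [] c h = sym (*-zeroʳ c)
  sumL-*ˡ (x ∷ xs) c h = trans (cong (c * h x +_) (sumL-*ˡ xs c h)) (sym (*-distribˡ-+ c (h x) _))

  sumL-zero : (xs : List A) {h : A → ℕ} → (∀ x → h x ≡ 0) → sumL xs h ≡ 0
  sumL-zero [] e = refl
  sumL-zero (x ∷ xs) e rewrite e x = sumL-zero xs e

module _ {A B : Set} where

  sumL-map : (f : A → B) (xs : List A) (h : B → ℕ) → sumL (map f xs) h ≡ ∑[ x ∈ xs ] h (f x)
  sumL-map f [] h = refl
  sumL-map f (x ∷ xs) h = cong (h (f x) +_) (sumL-map f xs h)

  sumL-concatMap : (f : A → List B) (xs : List A) (h : B → ℕ) → sumL (concatMap f xs) h ≡ ∑[ x ∈ xs ] sumL (f x) h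
  sumL-concatMap f [] h = refl
  sumL-concatMap f (x ∷ xs) h = trans (sumL-++ (f x) (concatMap f xs) h) (cong (sumL (f x) h +_) (sumL-concatMap f xs h))

  sumL-comm : (xs : List A) (ys : List B) (h : A → B → ℕ) → ∑[ x ∈ xs ] sumL ys (h x) ≡ ∑[ y ∈ ys ] ∑[ x ∈ xs ] h x y
  sumL-comm [] ys h = sym (sumL-zero ys (λ _ → refl))
  sumL-comm (x ∷ xs) ys h = trans (cong (sumL ys (h x) +_) (sumL-comm xs ys h)) (sym (sumL-+ ys (h x) _))

sumL-tabulate : ∀ {A : Set} n (f : Fin n → A) (h : A → ℕ) → sumL (tabulate f) h ≡ ∑[ i < n ] h (f i)
sumL-tabulate zero f h = refl
sumL-tabulate (suc n) f h = cong (h (f Fin.zero) +_) (sumL-tabulate n (f ∘ Fin.suc) h)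

sumL-allFin : ∀ n (h : Fin n → ℕ) → sumL (allFin n) h ≡ ∑[ i < n ] h i
sumL-allFin n = sumL-tabulate n (λ i → i)

module _ {A : Set} (_≟_ : DecidableEquality A) where

  δ : A → A → ℕ
  δ x y = 𝟙 (does (x ≟ y))

  record Enumerates (E : List A) : Set where
    field occurs-once : ∀ a → ∑[ x ∈ E ] δ x a ≡ 1

  sumL-δ : ∀ {E} → Enumerates E → ∀ a (h : A → ℕ) → ∑[ x ∈ E ] δ x a * h x ≡ h a
  sumL-δ {E} enum a h = begin
    ∑[ x ∈ E ] δ x a * h x    ≡⟨ sumL-cong E δ-subst ⟩
    ∑[ x ∈ E ] δ x a * h a    ≡⟨ sumL-cong E (λ x → *-comm (δ x a) (h a)) ⟩
    ∑[ x ∈ E ] h a * δ x a    ≡⟨ sumL-*ˡ E (h a) (λ x → δ x a) ⟩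
    h a * (∑[ x ∈ E ] δ x a)  ≡⟨ cong (h a *_) (Enumerates.occurs-once enum a) ⟩
    h a * 1                   ≡⟨ *-identityʳ (h a) ⟩
    h a                       ∎
    where
    open ≡-Reasoning
    δ-subst : ∀ x → δ x a * h x ≡ δ x a * h a
    δ-subst x with x ≟ a
    ... | yes refl = refl
    ... | no _ = refl

module _ {A B : Set} (_≟ᴬ_ : DecidableEquality A) (_≟ᴮ_ : DecidableEquality B)
         {EA : List A} {EB : List B} (enumA : Enumerates _≟ᴬ_ EA) (enumB : Enumerates _≟ᴮ_ EB)
         {PA : A → Bool} {PB : B → Bool} (f : A → B) (g : B → A)
         (gf : ∀ x → PA x ≡ true → PB (f x) ≡ true × g (f x) ≡ x)
         (fg : ∀ y → PB y ≡ true → PA (g y) ≡ true × f (g y) ≡ y) where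

  private
    δ-graph : ∀ x y → δ _≟ᴮ_ y (f x) * 𝟙 (PA x) ≡ δ _≟ᴬ_ x (g y) * 𝟙 (PB y)
    δ-graph x y with y ≟ᴮ f x | x ≟ᴬ g y | PA x in PAx | PB y in PBy
    ... | yes _    | yes _    | true  | true  = refl
    ... | yes _    | yes _    | false | false = refl
    ... | no _     | no _     | _     | _     = refl
    ... | yes _    | no _     | false | _     = refl
    ... | no _     | yes _    | _     | false = refl
    ... | yes refl | _        | true  | false = ⊥-elim (true≢false (trans (sym (proj₁ (gf x PAx))) PBy))
    ... | _        | yes refl | false | true  = ⊥-elim (true≢false (trans (sym (proj₁ (fg y PBy))) PAx))
    ... | yes refl | no x≢gy  | true  | true  = ⊥-elim (x≢gy (sym (proj₂ (gf x PAx))))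
    ... | no y≢fx  | yes refl | true  | true  = ⊥-elim (y≢fx (sym (proj₂ (fg y PBy))))

    rearrange : ∀ x y (k : ℕ) → 𝟙 (PA x) * (δ _≟ᴮ_ y (f x) * k) ≡ δ _≟ᴬ_ x (g y) * (𝟙 (PB y) * k)
    rearrange x y k = begin
      𝟙 (PA x) * (δ _≟ᴮ_ y (f x) * k)  ≡⟨ *-assoc (𝟙 (PA x)) _ k ⟨
      𝟙 (PA x) * δ _≟ᴮ_ y (f x) * k    ≡⟨ cong (_* k) (*-comm (𝟙 (PA x)) _) ⟩
      δ _≟ᴮ_ y (f x) * 𝟙 (PA x) * k    ≡⟨ cong (_* k) (δ-graph x y) ⟩
      δ _≟ᴬ_ x (g y) * 𝟙 (PB y) * k    ≡⟨ *-assoc (δ _≟ᴬ_ x (g y)) _ k ⟩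
      δ _≟ᴬ_ x (g y) * (𝟙 (PB y) * k)  ∎
      where open ≡-Reasoning

  sumL-reindex : (h : B → ℕ) → ∑[ x ∈ EA ] 𝟙 (PA x) * h (f x) ≡ ∑[ y ∈ EB ] 𝟙 (PB y) * h y
  sumL-reindex h = begin
    ∑[ x ∈ EA ] 𝟙 (PA x) * h (f x)
      ≡⟨ sumL-cong EA (λ x → cong (𝟙 (PA x) *_) (sumL-δ _≟ᴮ_ enumB (f x) h)) ⟨
    ∑[ x ∈ EA ] 𝟙 (PA x) * (∑[ y ∈ EB ] δ _≟ᴮ_ y (f x) * h y)
      ≡⟨ sumL-cong EA (λ x → sumL-*ˡ EB (𝟙 (PA x)) _) ⟨
    ∑[ x ∈ EA ] ∑[ y ∈ EB ] 𝟙 (PA x) * (δ _≟ᴮ_ y (f x) * h y)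
      ≡⟨ sumL-comm EA EB _ ⟩
    ∑[ y ∈ EB ] ∑[ x ∈ EA ] 𝟙 (PA x) * (δ _≟ᴮ_ y (f x) * h y)
      ≡⟨ sumL-cong EB (λ y → sumL-cong EA (λ x → rearrange x y (h y))) ⟩
    ∑[ y ∈ EB ] ∑[ x ∈ EA ] δ _≟ᴬ_ x (g y) * (𝟙 (PB y) * h y)
      ≡⟨ sumL-cong EB (λ y → sumL-δ _≟ᴬ_ enumA (g y) (λ _ → 𝟙 (PB y) * h y)) ⟩
    ∑[ y ∈ EB ] 𝟙 (PB y) * h y
      ∎
    where open ≡-Reasoning

module _ {A B C : Set} (_≟ᴬ_ : DecidableEquality A) (_≟ᴮ_ : DecidableEquality B) (_≟ᶜ_ : DecidableEquality C)
         {EA : List A} {EB : List B} (enumA : Enumerates _≟ᴬ_ EA) (enumB : Enumerates _≟ᴮ_ EB)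
         (c : A → B → C) (c-surjective : ∀ z → Σ A (λ a → Σ B (λ b → c a b ≡ z)))
         (c-injective : ∀ {a a′ b b′} → c a b ≡ c a′ b′ → a ≡ a′ × b ≡ b′) where

  concatMap-enumerates : Enumerates _≟ᶜ_ (concatMap (λ a → map (c a) EB) EA)
  concatMap-enumerates .Enumerates.occurs-once z with c-surjective z
  ... | a₀ , b₀ , refl = begin
    sumL (concatMap (λ a → map (c a) EB) EA) (λ z → δ _≟ᶜ_ z (c a₀ b₀))
      ≡⟨ sumL-concatMap _ EA _ ⟩
    ∑[ a ∈ EA ] sumL (map (c a) EB) (λ z → δ _≟ᶜ_ z (c a₀ b₀))
      ≡⟨ sumL-cong EA (λ a → sumL-map (c a) EB _) ⟩
    ∑[ a ∈ EA ] ∑[ b ∈ EB ] δ _≟ᶜ_ (c a b) (c a₀ b₀)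
      ≡⟨ sumL-cong EA (λ a → sumL-cong EB (δ-pair a)) ⟩
    ∑[ a ∈ EA ] ∑[ b ∈ EB ] δ _≟ᴬ_ a a₀ * δ _≟ᴮ_ b b₀
      ≡⟨ sumL-cong EA (λ a → sumL-*ˡ EB (δ _≟ᴬ_ a a₀) _) ⟩
    ∑[ a ∈ EA ] δ _≟ᴬ_ a a₀ * (∑[ b ∈ EB ] δ _≟ᴮ_ b b₀)
      ≡⟨ sumL-δ _≟ᴬ_ enumA a₀ _ ⟩
    ∑[ b ∈ EB ] δ _≟ᴮ_ b b₀
      ≡⟨ Enumerates.occurs-once enumB b₀ ⟩
    1 ∎
    where
    open ≡-Reasoning
    δ-pair : ∀ a b → δ _≟ᶜ_ (c a b) (c a₀ b₀) ≡ δ _≟ᴬ_ a a₀ * δ _≟ᴮ_ b b₀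
    δ-pair a b with c a b ≟ᶜ c a₀ b₀ | a ≟ᴬ a₀ | b ≟ᴮ b₀
    ... | yes _ | yes _ | yes _ = refl
    ... | yes e | no a≢a₀ | _ = ⊥-elim (a≢a₀ (proj₁ (c-injective e)))
    ... | yes e | yes _ | no b≢b₀ = ⊥-elim (b≢b₀ (proj₂ (c-injective e)))
    ... | no ne | yes refl | yes refl = ⊥-elim (ne refl)
    ... | no _ | no _ | _ = refl
    ... | no _ | yes _ | no _ = refl

module _ {A : Set} (_≟_ : DecidableEquality A) {E : List A} (enum : Enumerates _≟_ E)
         (f : A → A) (f-involutive : ∀ x → f (f x) ≡ x) where

  sumL-involution : (h : A → ℕ) → ∑[ x ∈ E ] h (f x) ≡ sumL E h
  sumL-involution h = begin
    ∑[ x ∈ E ] h (f x)          ≡⟨ sumL-cong E (λ x → +-identityʳ (h (f x))) ⟨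
    ∑[ x ∈ E ] 1 * h (f x)      ≡⟨ sumL-reindex _≟_ _≟_ enum enum {PA = λ _ → true} {PB = λ _ → true} f f
                                     (λ x _ → refl , f-involutive x) (λ x _ → refl , f-involutive x) h ⟩
    ∑[ x ∈ E ] 1 * h x          ≡⟨ sumL-cong E (λ x → +-identityʳ (h x)) ⟩
    sumL E h                    ∎
    where open ≡-Reasoning

Injective : ∀ {n} → Vec (Fin n) n → Set
Injective {n} π = ∀ i j → lookup π i ≡ lookup π j → i ≡ j

isPerm⇒injective : ∀ {n} (π : Vec (Fin n) n) → isPerm π ≡ true → Injective π
isPerm⇒injective {n} π e i j πi≡πj =
  toℕ-injective (≡ᵇ≡true⇒≡ (∨-not entry-i-j (≡⇒≡ᵇ≡true (cong toℕ πi≡πj))))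
  where
  entry-i-j = allᵇ-tabulate n _ (λ x → x) (allᵇ-tabulate n _ (λ x → x) e i) j
  ∨-not : ∀ {a b} → (a ∨ not b) ≡ true → b ≡ true → a ≡ true
  ∨-not {true} _ _ = refl
  ∨-not {false} {true} () refl

injective⇒isPerm : ∀ {n} (π : Vec (Fin n) n) → Injective π → isPerm π ≡ true
injective⇒isPerm {n} π inj = tabulate-allᵇ n _ (λ x → x) (λ i → tabulate-allᵇ n _ (λ x → x) (cell i))
  where
  cell : ∀ i j → ((toℕ i ≡ᵇ toℕ j) ∨ not (toℕ (lookup π i) ≡ᵇ toℕ (lookup π j))) ≡ true
  cell i j with toℕ i ≡ᵇ toℕ j in i≡ᵇj | toℕ (lookup π i) ≡ᵇ toℕ (lookup π j) in πi≡ᵇπj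
  ... | true | _ = refl
  ... | false | false = refl
  ... | false | true = ⊥-elim (true≢false (trans (sym (≡⇒≡ᵇ≡true (cong toℕ i≡j))) i≡ᵇj))
    where i≡j = inj i j (toℕ-injective (≡ᵇ≡true⇒≡ πi≡ᵇπj))

injective⇒surjective : ∀ {n} (π : Vec (Fin n) n) → Injective π → ∀ a → ∃ λ i → lookup π i ≡ a
injective⇒surjective {suc m} π inj a with any? (λ i → lookup π i Fin.≟ a)
... | yes hit = hit
... | no miss with pigeonhole (n<1+n m) (λ i → punchOut {j = lookup π i} (λ e → miss (i , sym e)))
...   | i , j , i<j , e =
  ⊥-elim (Fin.<-irrefl (inj i j (punchOut-injective (λ e → miss (i , sym e)) (λ e → miss (j , sym e)) e)) i<j)

punchIn-cases : ∀ {n} (p k : Fin (suc n)) → (k ≡ p) ⊎ (∃ λ k′ → punchIn p k′ ≡ k)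
punchIn-cases p k with k Fin.≟ p
... | yes k≡p = inj₁ k≡p
... | no k≢p = inj₂ (punchOut (k≢p ∘ sym) , punchIn-punchOut (k≢p ∘ sym))

insert : ∀ {n} → Fin (suc n) → Fin (suc n) → Vec (Fin n) n → Vec (Fin (suc n)) (suc n)
insert p a σ = insertAt (Vec.map (punchIn a) σ) p a

lookup-insert : ∀ {n} p a (σ : Vec (Fin n) n) → lookup (insert p a σ) p ≡ a
lookup-insert p a σ = insertAt-lookup (Vec.map (punchIn a) σ) p a

lookup-insert-punchIn : ∀ {n} p a (σ : Vec (Fin n) n) k → lookup (insert p a σ) (punchIn p k) ≡ punchIn a (lookup σ k)
lookup-insert-punchIn p a σ k = trans (insertAt-punchIn (Vec.map (punchIn a) σ) p a k) (lookup-map k (punchIn a) σ)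

lookup-insert⁻¹ : ∀ {n} p a (σ : Vec (Fin n) n) i → lookup (insert p a σ) i ≡ a → i ≡ p
lookup-insert⁻¹ p a σ i e with punchIn-cases p i
... | inj₁ i≡p = i≡p
... | inj₂ (k , refl) = ⊥-elim (punchInᵢ≢i a (lookup σ k) (trans (sym (lookup-insert-punchIn p a σ k)) e))

insert-injective : ∀ {n} p a (σ : Vec (Fin n) n) → Injective σ → Injective (insert p a σ)
insert-injective p a σ inj i j e with punchIn-cases p i | punchIn-cases p j
... | inj₁ refl | inj₁ refl = refl
... | inj₁ refl | inj₂ (k , refl) =
  ⊥-elim (punchInᵢ≢i a (lookup σ k) (sym (trans (sym (lookup-insert p a σ)) (trans e (lookup-insert-punchIn p a σ k)))))
... | inj₂ (k , refl) | inj₁ refl =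
  ⊥-elim (punchInᵢ≢i a (lookup σ k) (trans (sym (lookup-insert-punchIn p a σ k)) (trans e (lookup-insert p a σ))))
... | inj₂ (k , refl) | inj₂ (l , refl) =
  cong (punchIn p) (inj k l (punchIn-injective a _ _
    (trans (sym (lookup-insert-punchIn p a σ k)) (trans e (lookup-insert-punchIn p a σ l)))))

-- A total left inverse of punchIn a; punchOut needs a proof that its argument differs from a.
punchOut′ : ∀ {n} → Fin (suc (suc n)) → Fin (suc (suc n)) → Fin (suc n)
punchOut′ {zero} _ _ = Fin.zero
punchOut′ {suc n} Fin.zero Fin.zero = Fin.zero
punchOut′ {suc n} Fin.zero (Fin.suc b) = b
punchOut′ {suc n} (Fin.suc a) Fin.zero = Fin.zero
punchOut′ {suc n} (Fin.suc a) (Fin.suc b) = Fin.suc (punchOut′ a b)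

punchOut′-punchIn : ∀ {n} (a : Fin (suc (suc n))) y → punchOut′ a (punchIn a y) ≡ y
punchOut′-punchIn {zero} a Fin.zero = refl
punchOut′-punchIn {suc n} Fin.zero y = refl
punchOut′-punchIn {suc n} (Fin.suc a) Fin.zero = refl
punchOut′-punchIn {suc n} (Fin.suc a) (Fin.suc y) = cong Fin.suc (punchOut′-punchIn a y)

punchIn-punchOut′ : ∀ {n} (a b : Fin (suc (suc n))) → b ≢ a → punchIn a (punchOut′ a b) ≡ b
punchIn-punchOut′ {zero} Fin.zero Fin.zero b≢a = ⊥-elim (b≢a refl)
punchIn-punchOut′ {zero} Fin.zero (Fin.suc Fin.zero) b≢a = refl
punchIn-punchOut′ {zero} (Fin.suc Fin.zero) Fin.zero b≢a = refl
punchIn-punchOut′ {zero} (Fin.suc Fin.zero) (Fin.suc Fin.zero) b≢a = ⊥-elim (b≢a refl)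
punchIn-punchOut′ {suc n} Fin.zero Fin.zero b≢a = ⊥-elim (b≢a refl)
punchIn-punchOut′ {suc n} Fin.zero (Fin.suc b) b≢a = refl
punchIn-punchOut′ {suc n} (Fin.suc a) Fin.zero b≢a = refl
punchIn-punchOut′ {suc n} (Fin.suc a) (Fin.suc b) b≢a = cong Fin.suc (punchIn-punchOut′ a b (b≢a ∘ cong Fin.suc))

remove : ∀ {n} → Fin (suc n) → Fin (suc n) → Vec (Fin (suc n)) (suc n) → Vec (Fin n) n
remove {zero} p a v = []
remove {suc n} p a v = Vec.map (punchOut′ a) (removeAt v p)

lookup-removeAt : ∀ {A : Set} {n} (v : Vec A (suc n)) p k → lookup (removeAt v p) k ≡ lookup v (punchIn p k)
lookup-removeAt v p k =
  trans (cong (lookup (removeAt v p)) (sym (punchOut-punchIn p))) (removeAt-punchOut v (punchInᵢ≢i p k ∘ sym))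

lookup-remove : ∀ {n} p a (v : Vec (Fin (suc (suc n))) (suc (suc n))) k →
                lookup (remove p a v) k ≡ punchOut′ a (lookup v (punchIn p k))
lookup-remove p a v k = trans (lookup-map k (punchOut′ a) (removeAt v p)) (cong (punchOut′ a) (lookup-removeAt v p k))

lookup-extensional : ∀ {A : Set} {n} (xs ys : Vec A n) → (∀ i → lookup xs i ≡ lookup ys i) → xs ≡ ys
lookup-extensional xs ys e = trans (sym (tabulate∘lookup xs)) (trans (tabulate-cong e) (tabulate∘lookup ys))

remove-insert : ∀ {n} p a (σ : Vec (Fin n) n) → remove p a (insert p a σ) ≡ σ
remove-insert {zero} p a [] = refl
remove-insert {suc n} p a σ = begin
  Vec.map (punchOut′ a) (removeAt (insert p a σ) p)  ≡⟨ cong (Vec.map (punchOut′ a)) (removeAt-insertAt _ p a) ⟩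
  Vec.map (punchOut′ a) (Vec.map (punchIn a) σ)      ≡⟨ map-∘ (punchOut′ a) (punchIn a) σ ⟨
  Vec.map (punchOut′ a ∘ punchIn a) σ                ≡⟨ map-cong (punchOut′-punchIn a) σ ⟩
  Vec.map (λ x → x) σ                                ≡⟨ map-id σ ⟩
  σ                                                  ∎
  where open ≡-Reasoning

insert-remove : ∀ {n} p a (v : Vec (Fin (suc n)) (suc n)) → Injective v → lookup v p ≡ a → insert p a (remove p a v) ≡ v
insert-remove {zero} Fin.zero _ (x ∷ []) inj refl = refl
insert-remove {suc n} p _ v inj refl = trans (cong (λ w → insertAt w p a) punchIn-remove) (insertAt-removeAt v p)
  where
  a = lookup v p
  punchIn-remove : Vec.map (punchIn a) (remove p a v) ≡ removeAt v p
  punchIn-remove = lookup-extensional _ _ λ k → begin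
    lookup (Vec.map (punchIn a) (remove p a v)) k   ≡⟨ lookup-map k (punchIn a) (remove p a v) ⟩
    punchIn a (lookup (remove p a v) k)             ≡⟨ cong (punchIn a) (lookup-remove p a v k) ⟩
    punchIn a (punchOut′ a (lookup v (punchIn p k))) ≡⟨ punchIn-punchOut′ a _ (λ e → punchInᵢ≢i p k (inj _ _ e)) ⟩
    lookup v (punchIn p k)                          ≡⟨ lookup-removeAt v p k ⟨
    lookup (removeAt v p) k                         ∎
    where open ≡-Reasoning

remove-injective : ∀ {n} p a (v : Vec (Fin (suc n)) (suc n)) → Injective v → lookup v p ≡ a → Injective (remove p a v)
remove-injective {zero} p _ v inj refl ()
remove-injective {suc n} p _ v inj refl k l e = punchIn-injective p k l (inj _ _ (begin
  lookup v (punchIn p k)                            ≡⟨ punchIn-punchOut′ a _ (differs k) ⟨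
  punchIn a (punchOut′ a (lookup v (punchIn p k)))  ≡⟨ cong (punchIn a) removed-equal ⟩
  punchIn a (punchOut′ a (lookup v (punchIn p l)))  ≡⟨ punchIn-punchOut′ a _ (differs l) ⟩
  lookup v (punchIn p l)                            ∎))
  where
  open ≡-Reasoning
  a = lookup v p
  differs : ∀ k → lookup v (punchIn p k) ≢ a
  differs k e = punchInᵢ≢i p k (inj _ _ e)
  removed-equal : punchOut′ a (lookup v (punchIn p k)) ≡ punchOut′ a (lookup v (punchIn p l))
  removed-equal = trans (sym (lookup-remove p a v k)) (trans e (lookup-remove p a v l))

_≟ⱽ_ : ∀ {n m} → DecidableEquality (Vec (Fin n) m)
_≟ⱽ_ = Vec.≡-dec Fin._≟_

allFin-enumerates : ∀ n → Enumerates Fin._≟_ (allFin n)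
allFin-enumerates n .Enumerates.occurs-once a = trans (sumL-allFin n _) (sum-δ n a)
  where
  sum-δ : ∀ n (a : Fin n) → ∑[ x < n ] δ Fin._≟_ x a ≡ 1
  sum-δ (suc n) Fin.zero = cong suc (sum-replicate-zero n)
  sum-δ (suc n) (Fin.suc a) = sum-δ n a

allVecs-enumerates : ∀ n m → Enumerates _≟ⱽ_ (allVecs n m)
allVecs-enumerates n zero .Enumerates.occurs-once [] = refl
allVecs-enumerates n (suc m) =
  concatMap-enumerates Fin._≟_ _≟ⱽ_ _≟ⱽ_ (allFin-enumerates n) (allVecs-enumerates n m) _∷_
    (λ { (x ∷ xs) → x , xs , refl }) (λ { refl → refl , refl })

sumPerms : ∀ n → (Vec (Fin n) n → ℕ) → ℕ
sumPerms n h = ∑[ π ∈ allVecs n n ] 𝟙 (isPerm π) * h π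

s≡sumPerms : ∀ R n k → s R n k ≡ sumPerms n (λ π → 𝟙 (occ R π ≡ᵇ k))
s≡sumPerms R n k =
  trans (length-filterᵇ _ (perms n)) (sumL-filterᵇ isPerm (allVecs n n) (λ π → 𝟙 (occ R π ≡ᵇ k)))

module _ {n} (position value : Fin (suc n) → Fin (suc n)) (label : Vec (Fin (suc n)) (suc n) → Fin (suc n))
         (label-insert : ∀ x σ → label (insert (position x) (value x) σ) ≡ x)
         (lookup-label : ∀ v → Injective v → lookup v (position (label v)) ≡ value (label v)) where

  private
    _≟ᴾ_ : DecidableEquality (Fin (suc n) × Vec (Fin n) n)
    _≟ᴾ_ = Product.≡-dec Fin._≟_ _≟ⱽ_

    pairs : List (Fin (suc n) × Vec (Fin n) n)
    pairs = concatMap (λ x → map (x ,_) (allVecs n n)) (allFin (suc n))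

    pairs-enumerate : Enumerates _≟ᴾ_ pairs
    pairs-enumerate = concatMap-enumerates Fin._≟_ _≟ⱽ_ _≟ᴾ_ (allFin-enumerates (suc n)) (allVecs-enumerates n n) _,_
      (λ { (x , σ) → x , σ , refl }) (λ { refl → refl , refl })

    ins : Fin (suc n) × Vec (Fin n) n → Vec (Fin (suc n)) (suc n)
    ins (x , σ) = insert (position x) (value x) σ

    del : Vec (Fin (suc n)) (suc n) → Fin (suc n) × Vec (Fin n) n
    del v = label v , remove (position (label v)) (value (label v)) v

    del-ins : ∀ xσ → isPerm (proj₂ xσ) ≡ true → isPerm (ins xσ) ≡ true × del (ins xσ) ≡ xσ
    del-ins (x , σ) σ-perm =
      injective⇒isPerm (ins (x , σ)) (insert-injective (position x) (value x) σ (isPerm⇒injective σ σ-perm)) ,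
      cong₂ _,_ (label-insert x σ)
        (trans (cong (λ y → remove (position y) (value y) (ins (x , σ))) (label-insert x σ))
               (remove-insert (position x) (value x) σ))

    ins-del : ∀ v → isPerm v ≡ true → isPerm (proj₂ (del v)) ≡ true × ins (del v) ≡ v
    ins-del v v-perm =
      injective⇒isPerm (proj₂ (del v)) (remove-injective _ _ v v-inj (lookup-label v v-inj)) ,
      insert-remove _ _ v v-inj (lookup-label v v-inj)
      where v-inj = isPerm⇒injective v v-perm

  sumPerms-insert : (h : Vec (Fin (suc n)) (suc n) → ℕ) →
    sumPerms (suc n) h ≡ ∑[ x ∈ allFin (suc n) ] sumPerms n (λ σ → h (insert (position x) (value x) σ))
  sumPerms-insert h = begin
    sumPerms (suc n) h
      ≡⟨ sumL-reindex _≟ᴾ_ _≟ⱽ_ pairs-enumerate (allVecs-enumerates (suc n) (suc n)) ins del del-ins ins-del h ⟨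
    sumL pairs H
      ≡⟨ sumL-concatMap (λ x → map (x ,_) (allVecs n n)) (allFin (suc n)) H ⟩
    ∑[ x ∈ allFin (suc n) ] sumL (map (x ,_) (allVecs n n)) H
      ≡⟨ sumL-cong (allFin (suc n)) (λ x → sumL-map (x ,_) (allVecs n n) H) ⟩
    ∑[ x ∈ allFin (suc n) ] sumPerms n (λ σ → h (insert (position x) (value x) σ))
      ∎
    where
    open ≡-Reasoning
    H : Fin (suc n) × Vec (Fin n) n → ℕ
    H xσ = 𝟙 (isPerm (proj₂ xσ)) * h (ins xσ)

positionOf : ∀ {n} → Fin n → Vec (Fin n) n → Fin n
positionOf a v with any? (λ i → lookup v i Fin.≟ a)
... | yes (i , _) = i
... | no _ = a

lookup-positionOf : ∀ {n} a (v : Vec (Fin n) n) → Injective v → lookup v (positionOf a v) ≡ a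
lookup-positionOf a v inj with any? (λ i → lookup v i Fin.≟ a)
... | yes (i , e) = e
... | no miss = ⊥-elim (miss (injective⇒surjective v inj a))

positionOf-insert : ∀ {n} p a (σ : Vec (Fin n) n) → positionOf a (insert p a σ) ≡ p
positionOf-insert p a σ with any? (λ i → lookup (insert p a σ) i Fin.≟ a)
... | yes (i , e) = lookup-insert⁻¹ p a σ i e
... | no miss = ⊥-elim (miss (p , lookup-insert p a σ))

module _ {n} (φ : Fin (suc n) → Fin (suc n)) (φ-involutive : ∀ x → φ (φ x) ≡ x) where

  sumPerms-byValue : ∀ a (h : Vec (Fin (suc n)) (suc n) → ℕ) →
    sumPerms (suc n) h ≡ ∑[ x ∈ allFin (suc n) ] sumPerms n (λ σ → h (insert (φ x) a σ))
  sumPerms-byValue a = sumPerms-insert φ (λ _ → a) (λ v → φ (positionOf a v))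
    (λ x σ → trans (cong φ (positionOf-insert (φ x) a σ)) (φ-involutive x))
    (λ v inj → trans (cong (lookup v) (φ-involutive _)) (lookup-positionOf a v inj))

  sumPerms-byPosition : ∀ p (h : Vec (Fin (suc n)) (suc n) → ℕ) →
    sumPerms (suc n) h ≡ ∑[ x ∈ allFin (suc n) ] sumPerms n (λ σ → h (insert p (φ x) σ))
  sumPerms-byPosition p = sumPerms-insert (λ _ → p) φ (λ v → φ (lookup v p))
    (λ x σ → trans (cong φ (lookup-insert p (φ x) σ)) (φ-involutive x))
    (λ v inj → sym (φ-involutive _))

Code : ℕ → Set
Code zero = ⊤
Code (suc n) = Fin (suc n) × Code n

codes : ∀ n → List (Code n)
codes zero = tt ∷ []
codes (suc n) = concatMap (λ x → map (x ,_) (codes n)) (allFin (suc n))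

_≟ᶜ_ : ∀ {n} → DecidableEquality (Code n)
_≟ᶜ_ {zero} tt tt = yes refl
_≟ᶜ_ {suc n} = Product.≡-dec Fin._≟_ _≟ᶜ_

codes-enumerate : ∀ n → Enumerates _≟ᶜ_ (codes n)
codes-enumerate zero .Enumerates.occurs-once tt = refl
codes-enumerate (suc n) = concatMap-enumerates Fin._≟_ _≟ᶜ_ _≟ᶜ_ (allFin-enumerates (suc n)) (codes-enumerate n) _,_
  (λ { (x , c) → x , c , refl }) (λ { refl → refl , refl })

record Decomposition : Set where
  field
    position value : ∀ {n} → Fin (suc n) → Fin (suc n)
    sumPerms-decompose : ∀ {n} (h : Vec (Fin (suc n)) (suc n) → ℕ) →
      sumPerms (suc n) h ≡ ∑[ x ∈ allFin (suc n) ] sumPerms n (λ σ → h (insert (position x) (value x) σ))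

module _ (D : Decomposition) where
  open Decomposition D

  decode : ∀ {n} → Code n → Vec (Fin n) n
  decode {zero} tt = []
  decode {suc n} (x , c) = insert (position x) (value x) (decode c)

  decode-injective : ∀ {n} (c : Code n) → Injective (decode c)
  decode-injective {zero} tt ()
  decode-injective {suc n} (x , c) = insert-injective (position x) (value x) (decode c) (decode-injective c)

  sumPerms-decode : ∀ n (h : Vec (Fin n) n → ℕ) → sumPerms n h ≡ ∑[ c ∈ codes n ] h (decode c)
  sumPerms-decode zero h = cong (_+ 0) (+-identityʳ (h []))
  sumPerms-decode (suc n) h = begin
    sumPerms (suc n) h
      ≡⟨ sumPerms-decompose h ⟩
    ∑[ x ∈ allFin (suc n) ] sumPerms n (λ σ → h (insert (position x) (value x) σ))
      ≡⟨ sumL-cong (allFin (suc n)) (λ x → sumPerms-decode n _) ⟩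
    ∑[ x ∈ allFin (suc n) ] ∑[ c ∈ codes n ] h (decode (x , c))
      ≡⟨ sumL-cong (allFin (suc n)) (λ x → sumL-map (x ,_) (codes n) (h ∘ decode)) ⟨
    ∑[ x ∈ allFin (suc n) ] sumL (map (x ,_) (codes n)) (h ∘ decode)
      ≡⟨ sumL-concatMap (λ x → map (x ,_) (codes n)) (allFin (suc n)) (h ∘ decode) ⟨
    ∑[ c ∈ codes (suc n) ] h (decode c)
      ∎
    where open ≡-Reasoning

  s≡sumCodes : ∀ R n k → s R n k ≡ ∑[ c ∈ codes n ] 𝟙 (occ R (decode c) ≡ᵇ k)
  s≡sumCodes R n k = trans (s≡sumPerms R n k) (sumPerms-decode n (λ π → 𝟙 (occ R π ≡ᵇ k)))

byMinimum : Decomposition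
byMinimum = record
  { position = λ x → x ; value = λ _ → Fin.zero
  ; sumPerms-decompose = sumPerms-byValue (λ x → x) (λ _ → refl) Fin.zero }

byFirst : Decomposition
byFirst = record
  { position = λ _ → Fin.zero ; value = λ x → x
  ; sumPerms-decompose = sumPerms-byPosition (λ x → x) (λ _ → refl) Fin.zero }

-- The maximum and the last entry are recorded by the opposite of their position, resp. value,
-- so that all four decompositions lead to the same statistics on codes.
byMaximum : Decomposition
byMaximum = record
  { position = opposite ; value = λ {n} _ → fromℕ n
  ; sumPerms-decompose = λ {n} → sumPerms-byValue opposite opposite-involutive (fromℕ n) }

byLast : Decomposition
byLast = record
  { position = λ {n} _ → fromℕ n ; value = opposite
  ; sumPerms-decompose = λ {n} → sumPerms-byPosition opposite opposite-involutive (fromℕ n) }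

repeatCount : ∀ {n} → Code n → ℕ → ℕ
repeatCount {zero} tt q = 0
repeatCount {suc zero} (x , tt) q = 0
repeatCount {suc (suc n)} (x₁ , x₂ , c) q =
  𝟙 ((toℕ x₁ ≡ᵇ toℕ x₂) ∧ (toℕ x₁ <ᵇ q)) + repeatCount (x₂ , c) (toℕ x₁ ⊓ q)

topCount : ∀ {n} → Code n → ℕ → ℕ
topCount {zero} tt q = 0
topCount {suc zero} (x , tt) q = 0
topCount {suc (suc n)} (x₁ , x₂ , c) q =
  𝟙 ((toℕ x₂ ≡ᵇ n) ∧ (toℕ x₁ ≤ᵇ toℕ x₂) ∧ (toℕ x₁ <ᵇ q)) + topCount (x₂ , c) (toℕ x₁ ⊓ q)

module _ {n y x : ℕ} (x≤n : x ≤ n) where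

  reflected-≤ : y ≤ x → y + n ∸ x ≤ n
  reflected-≤ y≤x = ≤-trans (∸-monoˡ-≤ x (+-monoˡ-≤ n y≤x)) (≤-reflexive (m+n∸m≡n x n))

  reflected-≥ : y ≤ y + n ∸ x
  reflected-≥ = ≤-trans (m≤m+n y (n ∸ x)) (≤-reflexive (sym (+-∸-assoc y x≤n)))

  reflected-involutive : y + n ∸ (y + n ∸ x) ≡ x
  reflected-involutive = m∸[m∸n]≡n (≤-trans x≤n (m≤n+m n y))

  reflected≡n⇒≡ : y + n ∸ x ≡ n → y ≡ x
  reflected≡n⇒≡ e = +-cancelʳ-≡ n y x (begin
    y + n            ≡⟨ m∸n+n≡m (≤-trans x≤n (m≤n+m n y)) ⟨
    y + n ∸ x + x    ≡⟨ cong (_+ x) e ⟩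
    n + x            ≡⟨ +-comm n x ⟩
    x + n            ∎)
    where open ≡-Reasoning

reflectFin : ∀ {n} y (x : Fin (suc n)) → .(y ≤ toℕ x) → Fin (suc n)
reflectFin {n} y x y≤x = fromℕ< {y + n ∸ toℕ x} (s≤s (reflected-≤ (≤-pred (toℕ<n x)) y≤x))

-- If y is below the threshold q, x is reflected in the interval [y, n]; this exchanges x = y with x = n.
reflect : ∀ {n} → ℕ → ℕ → Fin (suc n) → Fin (suc n)
reflect q y x with y <ᵇ q | y ≤? toℕ x
... | true | yes y≤x = reflectFin y x y≤x
... | true | no _ = x
... | false | _ = x

module _ {n} (q y : ℕ) (x : Fin (suc n)) where

  reflect-reflects : (y <ᵇ q) ≡ true → (y≤x : y ≤ toℕ x) → reflect q y x ≡ reflectFin y x y≤x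
  reflect-reflects e y≤x with y <ᵇ q | y ≤? toℕ x
  ... | true | yes _ = refl
  ... | true | no y≰x = ⊥-elim (y≰x y≤x)

  reflect-≥q : (y <ᵇ q) ≡ false → reflect q y x ≡ x
  reflect-≥q e with y <ᵇ q | y ≤? toℕ x
  ... | false | _ = refl

  reflect-cases : (reflect q y x ≡ x) ⊎ (y < q × y ≤ toℕ x × y ≤ toℕ (reflect q y x))
  reflect-cases with y <ᵇ q in e | y ≤? toℕ x
  ... | false | _ = inj₁ refl
  ... | true | no _ = inj₁ refl
  ... | true | yes y≤x = inj₂ (<ᵇ≡true⇒< e , y≤x , subst (y ≤_) (sym (toℕ-fromℕ< _)) (reflected-≥ (≤-pred (toℕ<n x))))

reflect-involutive : ∀ {n} q y (x : Fin (suc n)) → reflect q y (reflect q y x) ≡ x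
reflect-involutive {n} q y x with reflect-cases q y x
... | inj₁ e = trans (cong (reflect q y) e) e
... | inj₂ (y<q , y≤x , y≤x′) = toℕ-injective (begin
  toℕ (reflect q y (reflect q y x))   ≡⟨ cong toℕ (reflect-reflects q y _ y<ᵇq y≤x′) ⟩
  toℕ (reflectFin y (reflect q y x) y≤x′) ≡⟨ toℕ-fromℕ< _ ⟩
  y + n ∸ toℕ (reflect q y x)         ≡⟨ cong (λ t → y + n ∸ toℕ t) (reflect-reflects q y x y<ᵇq y≤x) ⟩
  y + n ∸ toℕ (reflectFin y x y≤x)    ≡⟨ cong (λ t → y + n ∸ t) (toℕ-fromℕ< (s≤s (reflected-≤ {n} {y} (≤-pred (toℕ<n x)) y≤x))) ⟩
  y + n ∸ (y + n ∸ toℕ x)             ≡⟨ reflected-involutive {n} {y} (≤-pred (toℕ<n x)) ⟩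
  toℕ x                               ∎)
  where
  open ≡-Reasoning
  y<ᵇq = <⇒<ᵇ≡true y<q

repeat≡top : ∀ {n} q y (x : Fin (suc n)) →
  (y ≡ᵇ toℕ x) ∧ (y <ᵇ q) ≡ (toℕ (reflect q y x) ≡ᵇ n) ∧ (y ≤ᵇ toℕ (reflect q y x)) ∧ (y <ᵇ q)
repeat≡top {n} q y x with y <ᵇ q | y ≤? toℕ x
... | false | _ rewrite ∧-zeroʳ (y ≡ᵇ toℕ x) | ∧-zeroʳ (y ≤ᵇ toℕ x) | ∧-zeroʳ (toℕ x ≡ᵇ n) = refl
... | true | no y≰x
  rewrite ≢⇒≡ᵇ≡false {y} {toℕ x} (λ { refl → y≰x ≤-refl }) | >⇒≤ᵇ≡false {y} {toℕ x} (≰⇒> y≰x) = sym (∧-zeroʳ _)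
... | true | yes y≤x
  rewrite toℕ-fromℕ< (s≤s (reflected-≤ {n} {y} (≤-pred (toℕ<n x)) y≤x))
        | ≤⇒≤ᵇ≡true (reflected-≥ {n} {y} (≤-pred (toℕ<n x))) = cong (_∧ true) ≡ᵇ-reflected
  where
  ≡ᵇ-reflected : (y ≡ᵇ toℕ x) ≡ (y + n ∸ toℕ x ≡ᵇ n)
  ≡ᵇ-reflected = Bool-ext
    (λ e → ≡⇒≡ᵇ≡true (trans (cong (λ t → t + n ∸ toℕ x) (≡ᵇ≡true⇒≡ e)) (m+n∸m≡n (toℕ x) n)))
    (λ e → ≡⇒≡ᵇ≡true (reflected≡n⇒≡ (≤-pred (toℕ<n x)) (≡ᵇ≡true⇒≡ e)))

reflectFrom : ∀ {n} → ℕ → ℕ → Code n → Code n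
reflectFrom {zero} q y tt = tt
reflectFrom {suc n} q y (x , c) = reflect q y x , reflectFrom (y ⊓ q) (toℕ x) c

reflectCode : ∀ {n} → ℕ → Code n → Code n
reflectCode {zero} q tt = tt
reflectCode {suc n} q (y , c) = y , reflectFrom q (toℕ y) c

reflectFrom-irrelevant : ∀ {n} q y y′ (c : Code n) → q ≤ y → q ≤ y′ → reflectFrom q y c ≡ reflectFrom q y′ c
reflectFrom-irrelevant {zero} q y y′ tt _ _ = refl
reflectFrom-irrelevant {suc n} q y y′ (x , c) q≤y q≤y′
  rewrite reflect-≥q q y x (≥⇒<ᵇ≡false q≤y) | reflect-≥q q y′ x (≥⇒<ᵇ≡false q≤y′)
        | m≥n⇒m⊓n≡n q≤y | m≥n⇒m⊓n≡n q≤y′ = refl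

topCount-irrelevant : ∀ {n} q (x x′ : Fin (suc n)) (c : Code n) → q ≤ toℕ x → q ≤ toℕ x′ → topCount (x , c) q ≡ topCount (x′ , c) q
topCount-irrelevant {zero} q x x′ tt _ _ = refl
topCount-irrelevant {suc n} q x x′ (x₂ , c) q≤x q≤x′
  rewrite ≥⇒<ᵇ≡false q≤x | ≥⇒<ᵇ≡false q≤x′ | m≥n⇒m⊓n≡n q≤x | m≥n⇒m⊓n≡n q≤x′
        | ∧-zeroʳ (toℕ x ≤ᵇ toℕ x₂) | ∧-zeroʳ (toℕ x′ ≤ᵇ toℕ x₂) | ∧-zeroʳ (toℕ x₂ ≡ᵇ n) = refl

reflectFrom-involutive : ∀ {n} q y (c : Code n) → reflectFrom q y (reflectFrom q y c) ≡ c
reflectFrom-involutive {zero} q y tt = refl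
reflectFrom-involutive {suc n} q y (x , c) with reflect-cases q y x
... | inj₁ e rewrite e = cong₂ _,_ e (reflectFrom-involutive (y ⊓ q) (toℕ x) c)
... | inj₂ (y<q , y≤x , y≤x′) rewrite m≤n⇒m⊓n≡m (<⇒≤ y<q) =
  cong₂ _,_ (reflect-involutive q y x)
    (trans (reflectFrom-irrelevant y (toℕ (reflect q y x)) (toℕ x) _ y≤x′ y≤x) (reflectFrom-involutive y (toℕ x) c))

reflectCode-involutive : ∀ {n} q (c : Code n) → reflectCode q (reflectCode q c) ≡ c
reflectCode-involutive {zero} q tt = refl
reflectCode-involutive {suc n} q (y , c) = cong (y ,_) (reflectFrom-involutive q (toℕ y) c)

repeatCount≡topCount∘reflectFrom : ∀ {n} q (y : Fin (suc n)) (c : Code n) →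
  repeatCount (y , c) q ≡ topCount (y , reflectFrom q (toℕ y) c) q
repeatCount≡topCount∘reflectFrom {zero} q y tt = refl
repeatCount≡topCount∘reflectFrom {suc n} q y (x , c) = cong₂ _+_ (cong 𝟙 (repeat≡top q (toℕ y) x)) rest
  where
  rest : repeatCount (x , c) (toℕ y ⊓ q) ≡ topCount (reflect q (toℕ y) x , reflectFrom (toℕ y ⊓ q) (toℕ x) c) (toℕ y ⊓ q)
  rest with reflect-cases q (toℕ y) x
  ... | inj₁ e rewrite e = repeatCount≡topCount∘reflectFrom (toℕ y ⊓ q) x c
  ... | inj₂ (y<q , y≤x , y≤x′) rewrite m≤n⇒m⊓n≡m (<⇒≤ y<q) =
    trans (repeatCount≡topCount∘reflectFrom (toℕ y) x c) (topCount-irrelevant (toℕ y) x (reflect q (toℕ y) x) _ y≤x y≤x′)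

repeatCount≡topCount∘reflectCode : ∀ {n} q (c : Code n) → repeatCount c q ≡ topCount (reflectCode q c) q
repeatCount≡topCount∘reflectCode {zero} q tt = refl
repeatCount≡topCount∘reflectCode {suc n} q (y , c) = repeatCount≡topCount∘reflectFrom q y c

repeatCount-topCount-equidistributed : ∀ n k →
  ∑[ c ∈ codes n ] 𝟙 (repeatCount c n ≡ᵇ k) ≡ ∑[ c ∈ codes n ] 𝟙 (topCount c n ≡ᵇ k)
repeatCount-topCount-equidistributed n k =
  trans (sumL-cong (codes n) (λ c → cong (λ t → 𝟙 (t ≡ᵇ k)) (repeatCount≡topCount∘reflectCode n c)))
        (sumL-involution _≟ᶜ_ (codes-enumerate n) (reflectCode n) (reflectCode-involutive n) (λ c → 𝟙 (topCount c n ≡ᵇ k)))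

inBox : (Fin 4 → ℕ) → (Fin 4 → ℕ) → Fin 3 × Fin 3 → ℕ → ℕ → Bool
inBox xs ys (a , b) x y = (xs (inject₁ a) <ᵇ x) ∧ (x <ᵇ xs (Fin.suc a)) ∧ (ys (inject₁ b) <ᵇ y) ∧ (y <ᵇ ys (Fin.suc b))

anyFin : ∀ n → (Fin n → Bool) → Bool
anyFin zero f = false
anyFin (suc n) f = f Fin.zero ∨ anyFin n (f ∘ Fin.suc)

anyᵇ-tabulate : ∀ {A : Set} n (f : A → Bool) (g : Fin n → A) → anyᵇ f (tabulate g) ≡ anyFin n (f ∘ g)
anyᵇ-tabulate zero f g = refl
anyᵇ-tabulate (suc n) f g = cong (f (g Fin.zero) ∨_) (anyᵇ-tabulate n f (g ∘ Fin.suc))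

anyFin-cong : ∀ n {f g : Fin n → Bool} → (∀ i → f i ≡ g i) → anyFin n f ≡ anyFin n g
anyFin-cong zero e = refl
anyFin-cong (suc n) e = cong₂ _∨_ (e Fin.zero) (anyFin-cong n (e ∘ Fin.suc))

anyFin-punchIn : ∀ n (p : Fin (suc n)) (f : Fin (suc n) → Bool) → anyFin (suc n) f ≡ f p ∨ anyFin n (f ∘ punchIn p)
anyFin-punchIn n Fin.zero f = refl
anyFin-punchIn (suc n) (Fin.suc p) f = begin
  f₀ ∨ anyFin (suc n) (f ∘ Fin.suc)         ≡⟨ cong (f₀ ∨_) (anyFin-punchIn n p (f ∘ Fin.suc)) ⟩
  f₀ ∨ (f (Fin.suc p) ∨ rest)               ≡⟨ ∨-assoc f₀ _ rest ⟨
  (f₀ ∨ f (Fin.suc p)) ∨ rest               ≡⟨ cong (_∨ rest) (∨-comm f₀ (f (Fin.suc p))) ⟩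
  (f (Fin.suc p) ∨ f₀) ∨ rest               ≡⟨ ∨-assoc (f (Fin.suc p)) f₀ rest ⟩
  f (Fin.suc p) ∨ (f₀ ∨ rest)               ∎
  where
  open ≡-Reasoning
  f₀ = f Fin.zero
  rest = anyFin n (f ∘ Fin.suc ∘ punchIn p)

anyFin≡false : ∀ n (f : Fin n → Bool) → anyFin n f ≡ false → ∀ i → f i ≡ false
anyFin≡false (suc n) f e i with f Fin.zero in f₀
anyFin≡false (suc n) f e Fin.zero | false = f₀
anyFin≡false (suc n) f e (Fin.suc i) | false = anyFin≡false n (f ∘ Fin.suc) e i

false⇒anyFin≡false : ∀ n (f : Fin n → Bool) → (∀ i → f i ≡ false) → anyFin n f ≡ false
false⇒anyFin≡false zero f e = refl
false⇒anyFin≡false (suc n) f e rewrite e Fin.zero = false⇒anyFin≡false n (f ∘ Fin.suc) (e ∘ Fin.suc)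

boxEmpty≡ : ∀ {n} (π : Vec (Fin n) n) xs ys box → boxEmpty π xs ys box ≡ not (anyFin n (λ k → inBox xs ys box (pos k) (val π k)))
boxEmpty≡ {n} π xs ys box = cong not (anyᵇ-tabulate n _ (λ x → x))

-- 1-based coordinates of the old points after a new point is inserted at 0-based index c.
shift : ℕ → ℕ → ℕ
shift c zero = zero
shift zero (suc x) = suc (suc x)
shift (suc c) (suc x) = suc (shift c x)

shift-<ᵇ : ∀ c x y → (shift c x <ᵇ shift c y) ≡ (x <ᵇ y)
shift-<ᵇ c zero zero = refl
shift-<ᵇ zero zero (suc y) = refl
shift-<ᵇ (suc c) zero (suc y) = refl
shift-<ᵇ zero (suc x) zero = refl
shift-<ᵇ (suc c) (suc x) zero = refl
shift-<ᵇ zero (suc x) (suc y) = refl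
shift-<ᵇ (suc c) (suc x) (suc y) = shift-<ᵇ c x y

shift-≤ : ∀ c x → x ≤ c → shift c x ≡ x
shift-≤ c zero _ = refl
shift-≤ (suc c) (suc x) (s≤s x≤c) = cong suc (shift-≤ c x x≤c)

shift-> : ∀ c x → c < x → shift c x ≡ suc x
shift-> zero (suc x) _ = refl
shift-> (suc c) (suc x) (s≤s c<x) = cong suc (shift-> c x c<x)

shift-mono-< : ∀ c {x y} → x < y → shift c x < shift c y
shift-mono-< c {x} {y} x<y = <ᵇ≡true⇒< (trans (shift-<ᵇ c x y) (<⇒<ᵇ≡true x<y))

pos-punchIn : ∀ {n} (p : Fin (suc n)) (k : Fin n) → pos (punchIn p k) ≡ shift (toℕ p) (pos k)
pos-punchIn Fin.zero k = refl
pos-punchIn (Fin.suc p) Fin.zero = refl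
pos-punchIn (Fin.suc p) (Fin.suc k) = cong suc (pos-punchIn p k)

val-insert-punchIn : ∀ {n} p a (σ : Vec (Fin n) n) k → val (insert p a σ) (punchIn p k) ≡ shift (toℕ a) (val σ k)
val-insert-punchIn p a σ k = trans (cong (suc ∘ toℕ) (lookup-insert-punchIn p a σ k)) (pos-punchIn a (lookup σ k))

bounds-shift : ∀ n c u v (b : Fin 4) → c ≤ n → bounds (suc n) (shift c u) (shift c v) b ≡ shift c (bounds n u v b)
bounds-shift n c u v Fin.zero c≤n = refl
bounds-shift n c u v (Fin.suc Fin.zero) c≤n = refl
bounds-shift n c u v (Fin.suc (Fin.suc Fin.zero)) c≤n = refl
bounds-shift n c u v (Fin.suc (Fin.suc (Fin.suc Fin.zero))) c≤n = sym (shift-> c (suc n) (s≤s c≤n))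

inBox-shift : ∀ n c d u₁ u₂ v₁ v₂ box x y → c ≤ n → d ≤ n →
  inBox (bounds (suc n) (shift c u₁) (shift c u₂)) (bounds (suc n) (shift d v₁) (shift d v₂)) box (shift c x) (shift d y)
  ≡ inBox (bounds n u₁ u₂) (bounds n v₁ v₂) box x y
inBox-shift n c d u₁ u₂ v₁ v₂ (a , b) x y c≤n d≤n
  rewrite bounds-shift n c u₁ u₂ (inject₁ a) c≤n | bounds-shift n c u₁ u₂ (Fin.suc a) c≤n
        | bounds-shift n d v₁ v₂ (inject₁ b) d≤n | bounds-shift n d v₁ v₂ (Fin.suc b) d≤n
        | shift-<ᵇ c (bounds n u₁ u₂ (inject₁ a)) x | shift-<ᵇ c x (bounds n u₁ u₂ (Fin.suc a))
        | shift-<ᵇ d (bounds n v₁ v₂ (inject₁ b)) y | shift-<ᵇ d y (bounds n v₁ v₂ (Fin.suc b)) = refl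

isOccAt : ∀ {n} → MeshR → Vec (Fin n) n → ℕ → ℕ → ℕ → ℕ → Bool
isOccAt {n} R π x₁ x₂ y₁ y₂ = (x₁ <ᵇ x₂) ∧ (y₁ <ᵇ y₂) ∧ allᵇ (boxEmpty π (bounds n x₁ x₂) (bounds n y₁ y₂)) R

isOccAt-cong : ∀ {n} R (π : Vec (Fin n) n) {x₁ x₂ y₁ y₂ x₁′ x₂′ y₁′ y₂′} →
  x₁ ≡ x₁′ → x₂ ≡ x₂′ → y₁ ≡ y₁′ → y₂ ≡ y₂′ → isOccAt R π x₁ x₂ y₁ y₂ ≡ isOccAt R π x₁′ x₂′ y₁′ y₂′
isOccAt-cong R π refl refl refl refl = refl

newPointUnshaded : ∀ {n} → MeshR → Fin (suc n) → Fin (suc n) → Vec (Fin n) n → Fin n → Fin n → Bool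
newPointUnshaded {n} R p a σ i j =
  allᵇ (λ box → not (inBox (bounds (suc n) (shift (toℕ p) (pos i)) (shift (toℕ p) (pos j)))
                            (bounds (suc n) (shift (toℕ a) (val σ i)) (shift (toℕ a) (val σ j))) box (pos p) (suc (toℕ a)))) R

allᵇ-not-∨ : ∀ {A : Set} (R : List A) (e f : A → Bool) →
  allᵇ (λ x → not (e x ∨ f x)) R ≡ allᵇ (λ x → not (f x)) R ∧ allᵇ (λ x → not (e x)) R
allᵇ-not-∨ [] e f = refl
allᵇ-not-∨ (x ∷ R) e f rewrite allᵇ-not-∨ R e f with e x | f x
... | true | true = refl
... | true | false = sym (∧-zeroʳ _)
... | false | true = refl
... | false | false = refl

boxEmpty-insert : ∀ {n} p a (σ : Vec (Fin n) n) u₁ u₂ v₁ v₂ box →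
  let XS = bounds (suc n) (shift (toℕ p) u₁) (shift (toℕ p) u₂)
      YS = bounds (suc n) (shift (toℕ a) v₁) (shift (toℕ a) v₂) in
  boxEmpty (insert p a σ) XS YS box
    ≡ not (inBox XS YS box (pos p) (suc (toℕ a)) ∨ anyFin n (λ k → inBox (bounds n u₁ u₂) (bounds n v₁ v₂) box (pos k) (val σ k)))
boxEmpty-insert {n} p a σ u₁ u₂ v₁ v₂ box = trans (boxEmpty≡ π XS YS box) (cong not (trans
  (anyFin-punchIn n p (λ k → inBox XS YS box (pos k) (val π k)))
  (cong₂ _∨_ (cong (λ t → inBox XS YS box (pos p) (suc (toℕ t))) (lookup-insert p a σ))
             (anyFin-cong n (λ k → trans (cong₂ (inBox XS YS box) (pos-punchIn p k) (val-insert-punchIn p a σ k))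
                                         (inBox-shift n (toℕ p) (toℕ a) u₁ u₂ v₁ v₂ box (pos k) (val σ k)
                                                      (≤-pred (toℕ<n p)) (≤-pred (toℕ<n a))))))))
  where
  π = insert p a σ
  XS = bounds (suc n) (shift (toℕ p) u₁) (shift (toℕ p) u₂)
  YS = bounds (suc n) (shift (toℕ a) v₁) (shift (toℕ a) v₂)

isOcc-insert : ∀ {n} (R : MeshR) p a (σ : Vec (Fin n) n) i j →
  isOcc R (insert p a σ) (punchIn p i) (punchIn p j) ≡ isOcc R σ i j ∧ newPointUnshaded R p a σ i j
isOcc-insert {n} R p a σ i j = begin
  isOcc R π (punchIn p i) (punchIn p j)
    ≡⟨ isOccAt-cong R π (pos-punchIn p i) (pos-punchIn p j) (val-insert-punchIn p a σ i) (val-insert-punchIn p a σ j) ⟩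
  (shift cp (pos i) <ᵇ shift cp (pos j)) ∧ (shift ca (val σ i) <ᵇ shift ca (val σ j)) ∧ allᵇ (boxEmpty π XS YS) R
    ≡⟨ cong₂ (λ u v → u ∧ v ∧ allᵇ (boxEmpty π XS YS) R) (shift-<ᵇ cp (pos i) (pos j)) (shift-<ᵇ ca (val σ i) (val σ j)) ⟩
  (pos i <ᵇ pos j) ∧ (val σ i <ᵇ val σ j) ∧ allᵇ (boxEmpty π XS YS) R
    ≡⟨ cong (λ t → (pos i <ᵇ pos j) ∧ (val σ i <ᵇ val σ j) ∧ t) boxes ⟩
  (pos i <ᵇ pos j) ∧ (val σ i <ᵇ val σ j) ∧ (allᵇ (boxEmpty σ xs ys) R ∧ newPointUnshaded R p a σ i j)
    ≡⟨ cong ((pos i <ᵇ pos j) ∧_) (∧-assoc (val σ i <ᵇ val σ j) _ _) ⟨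
  (pos i <ᵇ pos j) ∧ ((val σ i <ᵇ val σ j) ∧ allᵇ (boxEmpty σ xs ys) R) ∧ newPointUnshaded R p a σ i j
    ≡⟨ ∧-assoc (pos i <ᵇ pos j) _ _ ⟨
  isOcc R σ i j ∧ newPointUnshaded R p a σ i j
    ∎
  where
  open ≡-Reasoning
  cp = toℕ p
  ca = toℕ a
  π = insert p a σ
  xs = bounds n (pos i) (pos j)
  ys = bounds n (val σ i) (val σ j)
  XS = bounds (suc n) (shift cp (pos i)) (shift cp (pos j))
  YS = bounds (suc n) (shift ca (val σ i)) (shift ca (val σ j))
  newPoint oldPoints : Fin 3 × Fin 3 → Bool
  newPoint box = inBox XS YS box (pos p) (suc ca)
  oldPoints box = anyFin n (λ k → inBox xs ys box (pos k) (val σ k))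
  boxes : allᵇ (boxEmpty π XS YS) R ≡ allᵇ (boxEmpty σ xs ys) R ∧ newPointUnshaded R p a σ i j
  boxes = begin
    allᵇ (boxEmpty π XS YS) R
      ≡⟨ allᵇ-cong R (boxEmpty-insert p a σ (pos i) (pos j) (val σ i) (val σ j)) ⟩
    allᵇ (λ box → not (newPoint box ∨ oldPoints box)) R
      ≡⟨ allᵇ-not-∨ R newPoint oldPoints ⟩
    allᵇ (λ box → not (oldPoints box)) R ∧ newPointUnshaded R p a σ i j
      ≡⟨ cong (_∧ newPointUnshaded R p a σ i j) (allᵇ-cong R (boxEmpty≡ σ xs ys)) ⟨
    allᵇ (boxEmpty σ xs ys) R ∧ newPointUnshaded R p a σ i j
      ∎

-- The threshold q records the entries removed earlier in a decomposition; this is how the shaded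
-- corner box (0,0), resp. (2,2), enters the recursion.
occBelow : ∀ {n} → MeshR → Vec (Fin n) n → (Fin n → Fin n → ℕ) → ℕ → ℕ
occBelow {n} R π key q = ∑[ i < n ] ∑[ j < n ] 𝟙 (isOcc R π i j ∧ (key i j <ᵇ q))

length≡sumL : ∀ {A : Set} (xs : List A) → length xs ≡ ∑[ x ∈ xs ] 1
length≡sumL [] = refl
length≡sumL (x ∷ xs) = cong suc (length≡sumL xs)

occ≡∑∑ : ∀ {n} R (π : Vec (Fin n) n) → occ R π ≡ ∑[ i < n ] ∑[ j < n ] 𝟙 (isOcc R π i j)
occ≡∑∑ {n} R π = begin
  length (concatMap row (allFin n))              ≡⟨ length≡sumL (concatMap row (allFin n)) ⟩
  sumL (concatMap row (allFin n)) (λ _ → 1)      ≡⟨ sumL-concatMap row (allFin n) (λ _ → 1) ⟩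
  ∑[ i ∈ allFin n ] sumL (row i) (λ _ → 1)       ≡⟨ sumL-allFin n (λ i → sumL (row i) (λ _ → 1)) ⟩
  ∑[ i < n ] sumL (row i) (λ _ → 1)              ≡⟨ sum-cong-≗ (λ i → sym (length≡sumL (row i))) ⟩
  ∑[ i < n ] length (row i)                      ≡⟨ sum-cong-≗ (λ i → length-filterᵇ (isOcc R π i) (allFin n)) ⟩
  ∑[ i < n ] sumL (allFin n) (λ j → 𝟙 (isOcc R π i j)) ≡⟨ sum-cong-≗ (λ i → sumL-allFin n (λ j → 𝟙 (isOcc R π i j))) ⟩
  ∑[ i < n ] ∑[ j < n ] 𝟙 (isOcc R π i j)        ∎
  where
  open ≡-Reasoning
  row : Fin n → List (Fin n)
  row i = filterᵇ (isOcc R π i) (allFin n)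

occ≡occBelow : ∀ {n} R (π : Vec (Fin n) n) key q → (∀ i j → key i j < q) → occ R π ≡ occBelow R π key q
occ≡occBelow {n} R π key q key<q = trans (occ≡∑∑ R π) (sum-cong-≗ (λ i → sum-cong-≗ (λ j →
  cong 𝟙 (sym (trans (cong (isOcc R π i j ∧_) (<⇒<ᵇ≡true (key<q i j))) (∧-identityʳ _))))))

∑∑-punchIn : ∀ n p (T : Fin (suc n) → Fin (suc n) → ℕ) →
  ∑[ i < suc n ] ∑[ j < suc n ] T i j ≡
  T p p + ∑[ j < n ] T p (punchIn p j) + (∑[ i < n ] T (punchIn p i) p + ∑[ i < n ] ∑[ j < n ] T (punchIn p i) (punchIn p j))
∑∑-punchIn n p T =
  trans (sum-remove (λ i → ∑[ j < suc n ] T i j))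
    (cong₂ _+_ (sum-remove (T p))
      (trans (sum-cong-≗ (λ i → sum-remove (T (punchIn p i)))) (∑-distrib-+ (λ i → T (punchIn p i) p) (λ i → ∑[ j < n ] T (punchIn p i) (punchIn p j)))))

∑-single : ∀ {m} (t : Fin m) (b : Bool) → ∑[ j < m ] 𝟙 ((toℕ j ≡ᵇ toℕ t) ∧ b) ≡ 𝟙 b
∑-single {suc m} Fin.zero b = trans (cong (𝟙 b +_) (sum-replicate-zero m)) (+-identityʳ (𝟙 b))
∑-single {suc m} (Fin.suc t) b = ∑-single t b

module _ {n} (R : MeshR) (π : Vec (Fin n) n) (i j : Fin n) (occurs : isOcc R π i j ≡ true) where

  occ-pos< : pos i < pos j
  occ-pos< = <ᵇ≡true⇒< (∧-trueˡ occurs)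

  occ-val< : val π i < val π j
  occ-val< = <ᵇ≡true⇒< (∧-trueˡ (∧-trueʳ (pos i <ᵇ pos j) occurs))

  occ-unshaded : ∀ {a b} → (a , b) ∈ R → ∀ k →
    let xs = bounds n (pos i) (pos j) ; ys = bounds n (val π i) (val π j) in
    xs (inject₁ a) < pos k → pos k < xs (Fin.suc a) → ys (inject₁ b) < val π k → val π k < ys (Fin.suc b) → ⊥
  occ-unshaded {a} {b} box∈R k x₁<x x<x₂ y₁<y y<y₂ = true≢false (begin
    true                                ≡⟨ inside ⟨
    inBox xs ys (a , b) (pos k) (val π k) ≡⟨ anyFin≡false n _ (not-true (trans (sym (boxEmpty≡ π xs ys (a , b))) empty)) k ⟩
    false                               ∎)
    where
    open ≡-Reasoning
    xs = bounds n (pos i) (pos j)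
    ys = bounds n (val π i) (val π j)
    empty : boxEmpty π xs ys (a , b) ≡ true
    empty = allᵇ-∈ _ R (∧-trueʳ (val π i <ᵇ val π j) (∧-trueʳ (pos i <ᵇ pos j) occurs)) box∈R
    not-true : ∀ {c} → not c ≡ true → c ≡ false
    not-true {false} _ = refl
    inside : inBox xs ys (a , b) (pos k) (val π k) ≡ true
    inside rewrite <⇒<ᵇ≡true x₁<x | <⇒<ᵇ≡true x<x₂ | <⇒<ᵇ≡true y₁<y | <⇒<ᵇ≡true y<y₂ = refl

module _ {n} (π : Vec (Fin n) n) (xs ys : Fin 4 → ℕ) (a b : Fin 3) where

  private
    nothing-between : ∀ {l x u} → l < x → x < u → u ≤ suc l → ⊥
    nothing-between l<x x<u u≤1+l = <-irrefl refl (≤-trans x<u (≤-trans u≤1+l l<x))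

  thin-column-empty : xs (Fin.suc a) ≤ suc (xs (inject₁ a)) → boxEmpty π xs ys (a , b) ≡ true
  thin-column-empty thin = trans (boxEmpty≡ π xs ys (a , b)) (cong not (false⇒anyFin≡false n _ (λ k → outside (pos k) (val π k))))
    where
    outside : ∀ x y → inBox xs ys (a , b) x y ≡ false
    outside x y with xs (inject₁ a) <ᵇ x in l<x | x <ᵇ xs (Fin.suc a) in x<u
    ... | false | _ = refl
    ... | true | false = refl
    ... | true | true = ⊥-elim (nothing-between (<ᵇ≡true⇒< l<x) (<ᵇ≡true⇒< x<u) thin)

  thin-row-empty : ys (Fin.suc b) ≤ suc (ys (inject₁ b)) → boxEmpty π xs ys (a , b) ≡ true
  thin-row-empty thin = trans (boxEmpty≡ π xs ys (a , b)) (cong not (false⇒anyFin≡false n _ (λ k → outside (pos k) (val π k))))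
    where
    outside : ∀ x y → inBox xs ys (a , b) x y ≡ false
    outside x y with xs (inject₁ a) <ᵇ x | x <ᵇ xs (Fin.suc a) | ys (inject₁ b) <ᵇ y in l<y | y <ᵇ ys (Fin.suc b) in y<u
    ... | false | _ | _ | _ = refl
    ... | true | false | _ | _ = refl
    ... | true | true | false | _ = refl
    ... | true | true | true | false = refl
    ... | true | true | true | true = ⊥-elim (nothing-between (<ᵇ≡true⇒< l<y) (<ᵇ≡true⇒< y<u) thin)

pos≤n : ∀ {n} (k : Fin n) → pos k ≤ n
pos≤n k = toℕ<n k

val≤n : ∀ {n} (π : Vec (Fin n) n) k → val π k ≤ n
val≤n π k = toℕ<n (lookup π k)

box₀₀ box₀₁ box₁₀ box₁₁ box₁₂ box₂₁ box₂₂ : Fin 3 × Fin 3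
box₀₀ = # 0 , # 0
box₀₁ = # 0 , # 1
box₁₀ = # 1 , # 0
box₁₁ = # 1 , # 1
box₁₂ = # 1 , # 2
box₂₁ = # 2 , # 1
box₂₂ = # 2 , # 2

occ-values-consecutive : ∀ {n} R (π : Vec (Fin n) n) i j → Injective π → isOcc R π i j ≡ true →
  box₁₁ ∈ R → (box₀₁ ∈ R ⊎ pos i ≡ 1) → (box₂₁ ∈ R ⊎ pos j ≡ n) → val π j ≡ suc (val π i)
occ-values-consecutive {n} R π i j inj occurs m₁₁ m₀₁ m₂₁ with <-cmp (val π j) (suc (val π i))
... | tri≈ _ e _ = e
... | tri< vj<1+vi _ _ = ⊥-elim (<⇒≱ vj<1+vi (occ-val< R π i j occurs))
... | tri> _ _ 1+vi<vj = ⊥-elim (middle (injective⇒surjective π inj (fromℕ< w<n)))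
  where
  w<n = ≤-trans (≤-pred 1+vi<vj) (<⇒≤ (toℕ<n (lookup π j)))
  middle : ∃ (λ k → lookup π k ≡ fromℕ< w<n) → ⊥
  middle (k , πk≡w) = column m₀₁ m₂₁ (<-cmp (pos k) (pos i)) (<-cmp (pos k) (pos j))
    where
    vk≡1+vi : val π k ≡ suc (val π i)
    vk≡1+vi = cong suc (trans (cong toℕ πk≡w) (toℕ-fromℕ< w<n))
    vi<vk : val π i < val π k
    vi<vk = ≤-reflexive (sym vk≡1+vi)
    vk<vj : val π k < val π j
    vk<vj = subst (_< val π j) (sym vk≡1+vi) 1+vi<vj
    pos-injective : ∀ {l} → pos k ≡ pos l → k ≡ l
    pos-injective e = toℕ-injective (suc-injective e)
    column : (box₀₁ ∈ R ⊎ pos i ≡ 1) → (box₂₁ ∈ R ⊎ pos j ≡ n) → _ → _ → ⊥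
    column (inj₁ m) _ (tri< k<i _ _) _ = occ-unshaded R π i j occurs m k (s≤s z≤n) k<i vi<vk vk<vj
    column (inj₂ pi≡1) _ (tri< k<i _ _) _ = <-irrefl refl (≤-trans k<i (≤-trans (≤-reflexive pi≡1) (s≤s z≤n)))
    column _ _ (tri≈ _ k≡i _) _ = <-irrefl (cong (val π) (sym (pos-injective k≡i))) vi<vk
    column _ _ (tri> _ _ i<k) (tri< k<j _ _) = occ-unshaded R π i j occurs m₁₁ k i<k k<j vi<vk vk<vj
    column _ _ (tri> _ _ i<k) (tri≈ _ k≡j _) = <-irrefl (cong (val π) (pos-injective k≡j)) vk<vj
    column _ (inj₁ m) (tri> _ _ i<k) (tri> _ _ j<k) = occ-unshaded R π i j occurs m k j<k (s≤s (pos≤n k)) vi<vk vk<vj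
    column _ (inj₂ pj≡n) (tri> _ _ i<k) (tri> _ _ j<k) = <-irrefl refl (≤-trans j<k (≤-trans (pos≤n k) (≤-reflexive (sym pj≡n))))

occ-positions-consecutive : ∀ {n} R (π : Vec (Fin n) n) i j → Injective π → isOcc R π i j ≡ true →
  box₁₁ ∈ R → (box₁₀ ∈ R ⊎ val π i ≡ 1) → (box₁₂ ∈ R ⊎ val π j ≡ n) → pos j ≡ suc (pos i)
occ-positions-consecutive {n} R π i j inj occurs m₁₁ m₁₀ m₁₂ with <-cmp (pos j) (suc (pos i))
... | tri≈ _ e _ = e
... | tri< pj<1+pi _ _ = ⊥-elim (<⇒≱ pj<1+pi (occ-pos< R π i j occurs))
... | tri> _ _ 1+pi<pj = ⊥-elim (row m₁₀ m₁₂ (<-cmp (val π k) (val π i)) (<-cmp (val π k) (val π j)))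
  where
  k<n = ≤-trans (≤-pred 1+pi<pj) (<⇒≤ (toℕ<n j))
  k = fromℕ< k<n
  pk≡1+pi : pos k ≡ suc (pos i)
  pk≡1+pi = cong suc (toℕ-fromℕ< k<n)
  pi<pk : pos i < pos k
  pi<pk = ≤-reflexive (sym pk≡1+pi)
  pk<pj : pos k < pos j
  pk<pj = subst (_< pos j) (sym pk≡1+pi) 1+pi<pj
  val-injective : ∀ {l} → val π k ≡ val π l → k ≡ l
  val-injective e = inj k _ (toℕ-injective (suc-injective e))
  row : (box₁₀ ∈ R ⊎ val π i ≡ 1) → (box₁₂ ∈ R ⊎ val π j ≡ n) → _ → _ → ⊥
  row (inj₁ m) _ (tri< k<i _ _) _ = occ-unshaded R π i j occurs m k pi<pk pk<pj (s≤s z≤n) k<i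
  row (inj₂ vi≡1) _ (tri< k<i _ _) _ = <-irrefl refl (≤-trans k<i (≤-trans (≤-reflexive vi≡1) (s≤s z≤n)))
  row _ _ (tri≈ _ k≡i _) _ = <-irrefl (cong pos (sym (val-injective k≡i))) pi<pk
  row _ _ (tri> _ _ i<k) (tri< k<j _ _) = occ-unshaded R π i j occurs m₁₁ k pi<pk pk<pj i<k k<j
  row _ _ (tri> _ _ i<k) (tri≈ _ k≡j _) = <-irrefl (cong pos (val-injective k≡j)) pk<pj
  row _ (inj₁ m) (tri> _ _ i<k) (tri> _ _ j<k) = occ-unshaded R π i j occurs m k pi<pk pk<pj j<k (s≤s (val≤n π k))
  row _ (inj₂ vj≡n) (tri> _ _ i<k) (tri> _ _ j<k) = <-irrefl refl (≤-trans j<k (≤-trans (val≤n π k) (≤-reflexive (sym vj≡n))))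

unshaded : MeshR → Fin 3 → Fin 3 → Bool
unshaded R c r = allᵇ (λ box → not ((toℕ (proj₁ box) ≡ᵇ toℕ c) ∧ (toℕ (proj₂ box) ≡ᵇ toℕ r))) R

InStrip : (Fin 4 → ℕ) → ℕ → Fin 3 → Set
InStrip zs z c = zs (inject₁ c) < z × z < zs (Fin.suc c)

inStrip-unique : ∀ zs z (c : Fin 3) → zs (# 1) ≤ zs (# 2) → InStrip zs z c →
  ∀ a → ((zs (inject₁ a) <ᵇ z) ∧ (z <ᵇ zs (Fin.suc a))) ≡ (toℕ a ≡ᵇ toℕ c)
inStrip-unique zs z 0F z₁≤z₂ (l<z , z<u) 0F rewrite <⇒<ᵇ≡true l<z | <⇒<ᵇ≡true z<u = refl
inStrip-unique zs z 0F z₁≤z₂ (l<z , z<u) 1F rewrite ≥⇒<ᵇ≡false (<⇒≤ z<u) = refl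
inStrip-unique zs z 0F z₁≤z₂ (l<z , z<u) 2F rewrite ≥⇒<ᵇ≡false (<⇒≤ (≤-trans z<u z₁≤z₂)) = refl
inStrip-unique zs z 1F z₁≤z₂ (l<z , z<u) 0F = ∧-falseʳ (zs 0F <ᵇ z) (≥⇒<ᵇ≡false (<⇒≤ l<z))
inStrip-unique zs z 1F z₁≤z₂ (l<z , z<u) 1F rewrite <⇒<ᵇ≡true l<z | <⇒<ᵇ≡true z<u = refl
inStrip-unique zs z 1F z₁≤z₂ (l<z , z<u) 2F rewrite ≥⇒<ᵇ≡false (<⇒≤ z<u) = refl
inStrip-unique zs z 2F z₁≤z₂ (l<z , z<u) 0F = ∧-falseʳ (zs 0F <ᵇ z) (≥⇒<ᵇ≡false (≤-trans z₁≤z₂ (<⇒≤ l<z)))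
inStrip-unique zs z 2F z₁≤z₂ (l<z , z<u) 1F = ∧-falseʳ (zs 1F <ᵇ z) (≥⇒<ᵇ≡false (<⇒≤ l<z))
inStrip-unique zs z 2F z₁≤z₂ (l<z , z<u) 2F rewrite <⇒<ᵇ≡true l<z | <⇒<ᵇ≡true z<u = refl

inBox-unique : ∀ xs ys x y (c r : Fin 3) → xs (# 1) ≤ xs (# 2) → ys (# 1) ≤ ys (# 2) → InStrip xs x c → InStrip ys y r →
  ∀ box → inBox xs ys box x y ≡ (toℕ (proj₁ box) ≡ᵇ toℕ c) ∧ (toℕ (proj₂ box) ≡ᵇ toℕ r)
inBox-unique xs ys x y c r xs-asc ys-asc x∈c y∈r (a , b) =
  trans (sym (∧-assoc (xs (inject₁ a) <ᵇ x) _ _))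
        (cong₂ _∧_ (inStrip-unique xs x c xs-asc x∈c a) (inStrip-unique ys y r ys-asc y∈r b))

newPointUnshaded≡unshaded : ∀ {N} R (p a : Fin (suc N)) (σ : Vec (Fin N) N) i j (c r : Fin 3) →
  pos i < pos j → val σ i < val σ j →
  InStrip (bounds (suc N) (shift (toℕ p) (pos i)) (shift (toℕ p) (pos j))) (pos p) c →
  InStrip (bounds (suc N) (shift (toℕ a) (val σ i)) (shift (toℕ a) (val σ j))) (suc (toℕ a)) r →
  newPointUnshaded R p a σ i j ≡ unshaded R c r
newPointUnshaded≡unshaded {N} R p a σ i j c r pi<pj vi<vj p∈c a∈r =
  allᵇ-cong R (λ box → cong not (inBox-unique (bounds (suc N) (shift (toℕ p) (pos i)) (shift (toℕ p) (pos j)))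
                                               (bounds (suc N) (shift (toℕ a) (val σ i)) (shift (toℕ a) (val σ j))) (pos p) (suc (toℕ a)) c r
    (<⇒≤ (shift-mono-< (toℕ p) pi<pj)) (<⇒≤ (shift-mono-< (toℕ a) vi<vj)) p∈c a∈r box))

data Position3 (c u v : ℕ) : Set where
  before : c < u → Position3 c u v
  inside : u ≤ c → c < v → Position3 c u v
  after : v ≤ c → Position3 c u v

position3 : ∀ c u v → Position3 c u v
position3 c u v with ≤-<-connex u c
... | inj₂ c<u = before c<u
... | inj₁ u≤c with ≤-<-connex v c
...   | inj₁ v≤c = after v≤c
...   | inj₂ c<v = inside u≤c c<v

module NewPointStrip (N c u v : ℕ) where

  zs : Fin 4 → ℕ
  zs = bounds (suc N) (shift c u) (shift c v)

  strip-before : c < u → InStrip zs (suc c) (# 0)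
  strip-before c<u = s≤s z≤n , subst (suc c <_) (sym (shift-> c u c<u)) (s≤s c<u)

  strip-inside : u ≤ c → c < v → InStrip zs (suc c) (# 1)
  strip-inside u≤c c<v = subst (_< suc c) (sym (shift-≤ c u u≤c)) (s≤s u≤c) , subst (suc c <_) (sym (shift-> c v c<v)) (s≤s c<v)

  strip-after : c ≤ N → v ≤ c → InStrip zs (suc c) (# 2)
  strip-after c≤N v≤c = subst (_< suc c) (sym (shift-≤ c v v≤c)) (s≤s v≤c) , s≤s (s≤s c≤N)

isOcc-diagonal : ∀ {n} R (π : Vec (Fin n) n) i → isOcc R π i i ≡ false
isOcc-diagonal R π i rewrite n<ᵇn≡false (toℕ i) = refl

isOccAt-true : ∀ {n} R (π : Vec (Fin n) n) {x₁ x₂ y₁ y₂} → x₁ < x₂ → y₁ < y₂ →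
  allᵇ (boxEmpty π (bounds n x₁ x₂) (bounds n y₁ y₂)) R ≡ true → isOccAt R π x₁ x₂ y₁ y₂ ≡ true
isOccAt-true R π x₁<x₂ y₁<y₂ empty rewrite <⇒<ᵇ≡true x₁<x₂ | <⇒<ᵇ≡true y₁<y₂ = empty

toℕ-punchIn-< : ∀ {n} (p : Fin (suc n)) (k : Fin n) → toℕ k < toℕ p → toℕ (punchIn p k) ≡ toℕ k
toℕ-punchIn-< p k k<p = suc-injective (trans (pos-punchIn p k) (shift-≤ (toℕ p) (suc (toℕ k)) k<p))

toℕ-punchIn-≥ : ∀ {n} (p : Fin (suc n)) (k : Fin n) → toℕ p ≤ toℕ k → toℕ (punchIn p k) ≡ suc (toℕ k)
toℕ-punchIn-≥ p k p≤k = suc-injective (trans (pos-punchIn p k) (shift-> (toℕ p) (suc (toℕ k)) (s≤s p≤k)))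

<ᵇ-⊓-< : ∀ {x c} q → x < c → (x <ᵇ q) ≡ (x <ᵇ c ⊓ q)
<ᵇ-⊓-< {x} {c} q x<c = Bool-ext
  (λ e → <⇒<ᵇ≡true (⊓-glb x<c (<ᵇ≡true⇒< e)))
  (λ e → <⇒<ᵇ≡true (≤-trans (<ᵇ≡true⇒< e) (m⊓n≤n c q)))

<ᵇ-⊓-≥ : ∀ {x c} q → c ≤ x → (x <ᵇ c ⊓ q) ≡ false
<ᵇ-⊓-≥ {x} {c} q c≤x = ≥⇒<ᵇ≡false (≤-trans (m⊓n≤m c q) c≤x)

𝟙-∧-guarded : ∀ (O E K K′ : Bool) → (O ≡ true → E ∧ K ≡ K′) → 𝟙 ((O ∧ E) ∧ K) ≡ 𝟙 (O ∧ K′)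
𝟙-∧-guarded false E K K′ h = refl
𝟙-∧-guarded true E K K′ h = cong 𝟙 (h refl)

∑-unique-partner : ∀ {n} (t : Fin n) (B K : Bool) (f : Fin n → Bool) → (∀ j → f j ≡ (toℕ j ≡ᵇ toℕ t) ∧ B) →
  ∑[ j < n ] 𝟙 (f j ∧ K) ≡ 𝟙 (B ∧ K)
∑-unique-partner t B K f f≡ =
  trans (sum-cong-≗ (λ j → cong 𝟙 (trans (cong (_∧ K) (f≡ j)) (∧-assoc (toℕ j ≡ᵇ toℕ t) B K)))) (∑-single t (B ∧ K))

∑-no-partner : ∀ {n} (f K : Fin n → Bool) → (∀ j → f j ≡ true → ⊥) → ∑[ j < n ] 𝟙 (f j ∧ K j) ≡ 0
∑-no-partner {n} f K none = trans (sum-cong-≗ (λ j → cong 𝟙 (term≡false j))) (sum-replicate-zero n)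
  where
  term≡false : ∀ j → f j ∧ K j ≡ false
  term≡false j with f j in fj
  ... | false = refl
  ... | true = ⊥-elim (none j fj)

occBelow-singleton : ∀ R (π : Vec (Fin 1) 1) key q → occBelow R π key q ≡ 0
occBelow-singleton R π key q rewrite isOcc-diagonal R π Fin.zero = refl

module _ {n} (R : MeshR) (p a : Fin (suc n)) (σ : Vec (Fin n) n)
         (key′ : Fin (suc n) → Fin (suc n) → ℕ) (q : ℕ) (key : Fin n → Fin n → ℕ) (q′ : ℕ) where

  private
    π = insert p a σ

  occBelow-insert :
    (∀ i j → 𝟙 (isOcc R π (punchIn p i) (punchIn p j) ∧ (key′ (punchIn p i) (punchIn p j) <ᵇ q)) ≡ 𝟙 (isOcc R σ i j ∧ (key i j <ᵇ q′))) →
    occBelow R π key′ q ≡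
      ∑[ j < n ] 𝟙 (isOcc R π p (punchIn p j) ∧ (key′ p (punchIn p j) <ᵇ q)) +
      (∑[ i < n ] 𝟙 (isOcc R π (punchIn p i) p ∧ (key′ (punchIn p i) p <ᵇ q)) + occBelow R σ key q′)
  occBelow-insert old-pairs =
    trans (∑∑-punchIn n p (λ i j → 𝟙 (isOcc R π i j ∧ (key′ i j <ᵇ q))))
      (cong₂ _+_ (cong (λ t → 𝟙 (t ∧ (key′ p p <ᵇ q)) + first) (isOcc-diagonal R π p))
                 (cong (second +_) (sum-cong-≗ (λ i → sum-cong-≗ (old-pairs i)))))
    where
    first = ∑[ j < n ] 𝟙 (isOcc R π p (punchIn p j) ∧ (key′ p (punchIn p j) <ᵇ q))
    second = ∑[ i < n ] 𝟙 (isOcc R π (punchIn p i) p ∧ (key′ (punchIn p i) p <ᵇ q))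

-- Removing the minimum: R1 and R5

leftPosition : ∀ {n} → Fin n → Fin n → ℕ
leftPosition i j = toℕ i

old-pairs-byMinimum : ∀ {N} (R : MeshR) → unshaded R 0F 0F ≡ false → unshaded R 1F 0F ≡ true → unshaded R 2F 0F ≡ true →
  ∀ (p : Fin (suc N)) (σ : Vec (Fin N) N) q i j →
  𝟙 (isOcc R (insert p Fin.zero σ) (punchIn p i) (punchIn p j) ∧ (toℕ (punchIn p i) <ᵇ q)) ≡ 𝟙 (isOcc R σ i j ∧ (toℕ i <ᵇ toℕ p ⊓ q))
old-pairs-byMinimum {N} R sh₀₀ sh₁₀ sh₂₀ p σ q i j =
  trans (cong (λ t → 𝟙 (t ∧ (toℕ (punchIn p i) <ᵇ q))) (isOcc-insert R p Fin.zero σ i j)) (𝟙-∧-guarded _ _ _ _ threshold)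
  where
  threshold : isOcc R σ i j ≡ true → newPointUnshaded R p Fin.zero σ i j ∧ (toℕ (punchIn p i) <ᵇ q) ≡ (toℕ i <ᵇ toℕ p ⊓ q)
  threshold occurs = by-column (position3 (toℕ p) (pos i) (pos j))
    where
    open NewPointStrip N (toℕ p) (pos i) (pos j)
    pi<pj = occ-pos< R σ i j occurs
    in-column : ∀ c → InStrip zs (pos p) c → newPointUnshaded R p Fin.zero σ i j ≡ unshaded R c 0F
    in-column c p∈c = newPointUnshaded≡unshaded R p Fin.zero σ i j c 0F pi<pj (occ-val< R σ i j occurs) p∈c (s≤s z≤n , s≤s (s≤s z≤n))
    by-column : Position3 (toℕ p) (pos i) (pos j) → newPointUnshaded R p Fin.zero σ i j ∧ (toℕ (punchIn p i) <ᵇ q) ≡ (toℕ i <ᵇ toℕ p ⊓ q)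
    by-column (before p<i) rewrite in-column 0F (strip-before p<i) | sh₀₀ = sym (<ᵇ-⊓-≥ q (≤-pred p<i))
    by-column (inside i≤p p<j) rewrite in-column 1F (strip-inside i≤p p<j) | sh₁₀ | toℕ-punchIn-< p i i≤p = <ᵇ-⊓-< q i≤p
    by-column (after j≤p) rewrite in-column 2F (strip-after (≤-pred (toℕ<n p)) j≤p) | sh₂₀
                                | toℕ-punchIn-< p i (≤-trans (≤-pred pi<pj) (<⇒≤ j≤p)) = <ᵇ-⊓-< q (≤-trans (≤-pred pi<pj) (<⇒≤ j≤p))

occBelow-byMinimum : ∀ (R : MeshR) → unshaded R 0F 0F ≡ false → unshaded R 1F 0F ≡ true → unshaded R 2F 0F ≡ true →
  ∀ {n} (p : Fin (suc n)) (σ : Vec (Fin n) n) (t : Fin n) q (B : Bool) →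
  (∀ j → isOcc R (insert p Fin.zero σ) p (punchIn p j) ≡ (toℕ j ≡ᵇ toℕ t) ∧ B) →
  occBelow R (insert p Fin.zero σ) leftPosition q ≡ 𝟙 (B ∧ (toℕ p <ᵇ q)) + occBelow R σ leftPosition (toℕ p ⊓ q)
occBelow-byMinimum R sh₀₀ sh₁₀ sh₂₀ p σ t q B partner =
  trans (occBelow-insert R p Fin.zero σ leftPosition q leftPosition (toℕ p ⊓ q) (old-pairs-byMinimum R sh₀₀ sh₁₀ sh₂₀ p σ q))
    (cong₂ _+_ (∑-unique-partner t B (toℕ p <ᵇ q) (λ j → isOcc R π p (punchIn p j)) partner)
               (cong (_+ occBelow R σ leftPosition (toℕ p ⊓ q))
                     (∑-no-partner (λ i → isOcc R π (punchIn p i) p) (λ i → toℕ (punchIn p i) <ᵇ q) minimum-is-not-second)))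
  where
  π = insert p Fin.zero σ
  minimum-is-not-second : ∀ i → isOcc R π (punchIn p i) p ≡ true → ⊥
  minimum-is-not-second i occurs = <⇒≱ (occ-val< R π (punchIn p i) p occurs)
    (subst (_≤ val π (punchIn p i)) (sym (cong (suc ∘ toℕ) (lookup-insert p Fin.zero σ))) (s≤s z≤n))

module TwoSmallest {n} (p : Fin (suc (suc n))) (x₂ : Fin (suc n)) (σ′ : Vec (Fin n) n) (inj : Injective σ′) where

  σ = insert x₂ Fin.zero σ′
  π = insert p Fin.zero σ
  π-injective = insert-injective p Fin.zero σ (insert-injective x₂ Fin.zero σ′ inj)

  val-p : val π p ≡ 1
  val-p = cong (suc ∘ toℕ) (lookup-insert p Fin.zero σ)

  val-punchIn : ∀ j → val π (punchIn p j) ≡ suc (val σ j)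
  val-punchIn j = val-insert-punchIn p Fin.zero σ j

  val≡2⇒x₂ : ∀ j → val π (punchIn p j) ≡ 2 → j ≡ x₂
  val≡2⇒x₂ j e = lookup-insert⁻¹ x₂ Fin.zero σ′ j (toℕ-injective (suc-injective (suc-injective (trans (sym (val-punchIn j)) e))))

  val-x₂ : val π (punchIn p x₂) ≡ 2
  val-x₂ = trans (val-punchIn x₂) (cong (suc ∘ suc ∘ toℕ) (lookup-insert x₂ Fin.zero σ′))

  1<val-others : ∀ l → l ≢ x₂ → 1 < val σ l
  1<val-others l l≢x₂ with punchIn-cases x₂ l
  ... | inj₁ l≡x₂ = ⊥-elim (l≢x₂ l≡x₂)
  ... | inj₂ (l′ , refl) = subst (1 <_) (sym (cong (suc ∘ toℕ) (lookup-insert-punchIn x₂ Fin.zero σ′ l′))) (s≤s (s≤s z≤n))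

  partner-is-x₂ : ∀ R j → isOcc R π p (punchIn p j) ≡ true → box₀₁ ∈ R → box₁₁ ∈ R → box₂₁ ∈ R → j ≡ x₂
  partner-is-x₂ R j occurs m₀₁ m₁₁ m₂₁ =
    val≡2⇒x₂ j (trans (occ-values-consecutive R π p (punchIn p j) π-injective occurs m₁₁ (inj₁ m₀₁) (inj₁ m₂₁)) (cong suc val-p))

  after-p : ∀ j → pos p < pos (punchIn p j) → toℕ p ≤ toℕ j
  after-p j p<j with <-cmp (toℕ j) (toℕ p)
  ... | tri< j<p _ _ = ⊥-elim (<-asym (subst (_< toℕ p) (sym (toℕ-punchIn-< p j j<p)) j<p) (≤-pred p<j))
  ... | tri≈ _ j≡p _ = ≤-reflexive (sym j≡p)
  ... | tri> _ _ p<j′ = <⇒≤ p<j′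

  -- A position of σ after x₂ would put a point in the box (2,2) of the occurrence.
  x₂-last : ∀ R → isOcc R π p (punchIn p x₂) ≡ true → box₂₂ ∈ R → toℕ x₂ ≡ n
  x₂-last R occurs m₂₂ with toℕ x₂ ≟ n
  ... | yes x₂≡n = x₂≡n
  ... | no x₂≢n = ⊥-elim (occ-unshaded R π p (punchIn p x₂) occurs m₂₂ (punchIn p l)
                            x₂<l (s≤s (pos≤n (punchIn p l))) v₂<vl (s≤s (val≤n π (punchIn p l))))
    where
    l = fromℕ n
    l≢x₂ : l ≢ x₂
    l≢x₂ e = x₂≢n (trans (sym (cong toℕ e)) (toℕ-fromℕ n))
    x₂<l : pos (punchIn p x₂) < pos (punchIn p l)
    x₂<l = subst₂ _<_ (sym (pos-punchIn p x₂)) (sym (pos-punchIn p l)) (shift-mono-< (toℕ p)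
             (s≤s (subst (toℕ x₂ <_) (sym (toℕ-fromℕ n)) (≤∧≢⇒< (≤-pred (toℕ<n x₂)) x₂≢n))))
    v₂<vl : val π (punchIn p x₂) < val π (punchIn p l)
    v₂<vl = subst₂ _<_ (sym val-x₂) (sym (val-punchIn l)) (s≤s (1<val-others l l≢x₂))

partner-R1 : ∀ {n} (p : Fin (suc (suc n))) (x₂ : Fin (suc n)) (σ′ : Vec (Fin n) n) → Injective σ′ → ∀ j →
  isOcc R1 (insert p Fin.zero (insert x₂ Fin.zero σ′)) p (punchIn p j) ≡ (toℕ j ≡ᵇ toℕ x₂) ∧ (toℕ p ≡ᵇ toℕ x₂)
partner-R1 {n} p x₂ σ′ inj j = Bool-ext occurrence⇒ ⇒occurrence
  where
  open TwoSmallest p x₂ σ′ inj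
  occurrence⇒ : isOcc R1 π p (punchIn p j) ≡ true → (toℕ j ≡ᵇ toℕ x₂) ∧ (toℕ p ≡ᵇ toℕ x₂) ≡ true
  occurrence⇒ occurs = ∧-true (≡⇒≡ᵇ≡true (cong toℕ j≡x₂)) (≡⇒≡ᵇ≡true (trans (sym j≡p) (cong toℕ j≡x₂)))
    where
    j≡x₂ : j ≡ x₂
    j≡x₂ = partner-is-x₂ R1 j occurs (there (here refl)) (there (there (here refl))) (there (there (there (here refl))))
    j≡p : toℕ j ≡ toℕ p
    j≡p = suc-injective (trans (sym (toℕ-punchIn-≥ p j (after-p j (occ-pos< R1 π p (punchIn p j) occurs))))
                               (suc-injective (occ-positions-consecutive R1 π p (punchIn p j) π-injective occurs
                                                 (there (there (here refl))) (inj₂ val-p) (inj₁ (here refl)))))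
  ⇒occurrence : (toℕ j ≡ᵇ toℕ x₂) ∧ (toℕ p ≡ᵇ toℕ x₂) ≡ true → isOcc R1 π p (punchIn p j) ≡ true
  ⇒occurrence e = trans (isOccAt-cong R1 π {x₁′ = pos p} refl pos-j val-p (trans (cong (val π ∘ punchIn p) j≡x₂) val-x₂))
                        (isOccAt-true R1 π (s≤s (n<1+n (toℕ p))) (s≤s (s≤s z≤n)) boxes)
    where
    j≡x₂ : j ≡ x₂
    j≡x₂ = toℕ-injective (≡ᵇ≡true⇒≡ (∧-trueˡ e))
    p≡x₂ : toℕ p ≡ toℕ x₂
    p≡x₂ = ≡ᵇ≡true⇒≡ (∧-trueʳ (toℕ j ≡ᵇ toℕ x₂) e)
    pos-j : pos (punchIn p j) ≡ suc (suc (toℕ p))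
    pos-j = cong suc (trans (toℕ-punchIn-≥ p j (≤-reflexive (trans p≡x₂ (sym (cong toℕ j≡x₂)))))
                            (cong suc (trans (cong toℕ j≡x₂) (sym p≡x₂))))
    XS = bounds (suc (suc n)) (suc (toℕ p)) (suc (suc (toℕ p)))
    YS = bounds (suc (suc n)) 1 2
    boxes : allᵇ (boxEmpty π XS YS) R1 ≡ true
    boxes = ∧-true (thin-column-empty π XS YS 1F 2F ≤-refl)
           (∧-true (thin-row-empty π XS YS 0F 1F ≤-refl)
           (∧-true (thin-row-empty π XS YS 1F 1F ≤-refl)
           (∧-true (thin-row-empty π XS YS 2F 1F ≤-refl)
           (∧-true (thin-row-empty π XS YS 0F 0F ≤-refl) refl))))

occBelow-R1 : ∀ {n} (c : Code n) q → occBelow R1 (decode byMinimum c) leftPosition q ≡ repeatCount c q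
occBelow-R1 {zero} tt q = refl
occBelow-R1 {suc zero} (x , tt) q = occBelow-singleton R1 (decode byMinimum (x , tt)) leftPosition q
occBelow-R1 {suc (suc n)} (x₁ , x₂ , c) q =
  trans (occBelow-byMinimum R1 refl refl refl x₁ (decode byMinimum (x₂ , c)) x₂ q (toℕ x₁ ≡ᵇ toℕ x₂)
                            (partner-R1 x₁ x₂ (decode byMinimum c) (decode-injective byMinimum c)))
        (cong (𝟙 ((toℕ x₁ ≡ᵇ toℕ x₂) ∧ (toℕ x₁ <ᵇ q)) +_) (occBelow-R1 (x₂ , c) (toℕ x₁ ⊓ q)))

partner-R5 : ∀ {n} (p : Fin (suc (suc n))) (x₂ : Fin (suc n)) (σ′ : Vec (Fin n) n) → Injective σ′ → ∀ j →
  isOcc R5 (insert p Fin.zero (insert x₂ Fin.zero σ′)) p (punchIn p j) ≡ (toℕ j ≡ᵇ toℕ x₂) ∧ (toℕ x₂ ≡ᵇ n) ∧ (toℕ p ≤ᵇ toℕ x₂)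
partner-R5 {n} p x₂ σ′ inj j = Bool-ext occurrence⇒ ⇒occurrence
  where
  open TwoSmallest p x₂ σ′ inj
  occurrence⇒ : isOcc R5 π p (punchIn p j) ≡ true → (toℕ j ≡ᵇ toℕ x₂) ∧ (toℕ x₂ ≡ᵇ n) ∧ (toℕ p ≤ᵇ toℕ x₂) ≡ true
  occurrence⇒ occurs = ∧-true (≡⇒≡ᵇ≡true (cong toℕ j≡x₂)) (∧-true (≡⇒≡ᵇ≡true x₂≡n)
                         (≤⇒≤ᵇ≡true (subst (toℕ p ≤_) (cong toℕ j≡x₂) (after-p j (occ-pos< R5 π p (punchIn p j) occurs)))))
    where
    j≡x₂ : j ≡ x₂
    j≡x₂ = partner-is-x₂ R5 j occurs (there (here refl)) (there (there (here refl))) (there (there (there (here refl))))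
    x₂≡n : toℕ x₂ ≡ n
    x₂≡n = x₂-last R5 (subst (λ t → isOcc R5 π p (punchIn p t) ≡ true) j≡x₂ occurs) (here refl)
  ⇒occurrence : (toℕ j ≡ᵇ toℕ x₂) ∧ (toℕ x₂ ≡ᵇ n) ∧ (toℕ p ≤ᵇ toℕ x₂) ≡ true → isOcc R5 π p (punchIn p j) ≡ true
  ⇒occurrence e = trans (isOccAt-cong R5 π {x₁′ = pos p} refl pos-j val-p (trans (cong (val π ∘ punchIn p) j≡x₂) val-x₂))
                        (isOccAt-true R5 π (s≤s (s≤s (subst (toℕ p ≤_) x₂≡n p≤x₂))) (s≤s (s≤s z≤n)) boxes)
    where
    j≡x₂ : j ≡ x₂
    j≡x₂ = toℕ-injective (≡ᵇ≡true⇒≡ (∧-trueˡ e))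
    x₂≡n : toℕ x₂ ≡ n
    x₂≡n = ≡ᵇ≡true⇒≡ (∧-trueˡ (∧-trueʳ (toℕ j ≡ᵇ toℕ x₂) e))
    p≤x₂ : toℕ p ≤ toℕ x₂
    p≤x₂ = ≤ᵇ≡true⇒≤ (∧-trueʳ (toℕ x₂ ≡ᵇ n) (∧-trueʳ (toℕ j ≡ᵇ toℕ x₂) e))
    pos-j : pos (punchIn p j) ≡ suc (suc n)
    pos-j = cong suc (trans (toℕ-punchIn-≥ p j (subst (toℕ p ≤_) (sym (cong toℕ j≡x₂)) p≤x₂))
                            (cong suc (trans (cong toℕ j≡x₂) x₂≡n)))
    XS = bounds (suc (suc n)) (suc (toℕ p)) (suc (suc n))
    YS = bounds (suc (suc n)) 1 2
    boxes : allᵇ (boxEmpty π XS YS) R5 ≡ true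
    boxes = ∧-true (thin-column-empty π XS YS 2F 2F ≤-refl)
           (∧-true (thin-row-empty π XS YS 0F 1F ≤-refl)
           (∧-true (thin-row-empty π XS YS 1F 1F ≤-refl)
           (∧-true (thin-row-empty π XS YS 2F 1F ≤-refl)
           (∧-true (thin-row-empty π XS YS 0F 0F ≤-refl) refl))))

occBelow-R5 : ∀ {n} (c : Code n) q → occBelow R5 (decode byMinimum c) leftPosition q ≡ topCount c q
occBelow-R5 {zero} tt q = refl
occBelow-R5 {suc zero} (x , tt) q = occBelow-singleton R5 (decode byMinimum (x , tt)) leftPosition q
occBelow-R5 {suc (suc n)} (x₁ , x₂ , c) q =
  trans (occBelow-byMinimum R5 refl refl refl x₁ (decode byMinimum (x₂ , c)) x₂ q ((toℕ x₂ ≡ᵇ n) ∧ (toℕ x₁ ≤ᵇ toℕ x₂))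
                            (partner-R5 x₁ x₂ (decode byMinimum c) (decode-injective byMinimum c)))
        (cong₂ _+_ (cong 𝟙 (∧-assoc (toℕ x₂ ≡ᵇ n) (toℕ x₁ ≤ᵇ toℕ x₂) (toℕ x₁ <ᵇ q))) (occBelow-R5 (x₂ , c) (toℕ x₁ ⊓ q)))

-- Removing the first entry: R4 and R6

lowerValue : ∀ {n} → Vec (Fin n) n → Fin n → Fin n → ℕ
lowerValue π i j = toℕ (lookup π i)

old-pairs-byFirst : ∀ {N} (R : MeshR) → unshaded R 0F 0F ≡ false → unshaded R 0F 1F ≡ true → unshaded R 0F 2F ≡ true →
  ∀ (a : Fin (suc N)) (σ : Vec (Fin N) N) q i j →
  𝟙 (isOcc R (insert Fin.zero a σ) (Fin.suc i) (Fin.suc j) ∧ (lowerValue (insert Fin.zero a σ) (Fin.suc i) (Fin.suc j) <ᵇ q))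
    ≡ 𝟙 (isOcc R σ i j ∧ (lowerValue σ i j <ᵇ toℕ a ⊓ q))
old-pairs-byFirst {N} R sh₀₀ sh₀₁ sh₀₂ a σ q i j =
  trans (cong (λ t → 𝟙 (t ∧ (lowerValue π (Fin.suc i) (Fin.suc j) <ᵇ q))) (isOcc-insert R Fin.zero a σ i j)) (𝟙-∧-guarded _ _ _ _ threshold)
  where
  π = insert Fin.zero a σ
  threshold : isOcc R σ i j ≡ true → newPointUnshaded R Fin.zero a σ i j ∧ (lowerValue π (Fin.suc i) (Fin.suc j) <ᵇ q) ≡ (toℕ (lookup σ i) <ᵇ toℕ a ⊓ q)
  threshold occurs rewrite lookup-insert-punchIn Fin.zero a σ i = by-row (position3 (toℕ a) (val σ i) (val σ j))
    where
    open NewPointStrip N (toℕ a) (val σ i) (val σ j)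
    vi<vj = occ-val< R σ i j occurs
    in-row : ∀ r → InStrip zs (suc (toℕ a)) r → newPointUnshaded R Fin.zero a σ i j ≡ unshaded R 0F r
    in-row r a∈r = newPointUnshaded≡unshaded R Fin.zero a σ i j 0F r (occ-pos< R σ i j occurs) vi<vj (s≤s z≤n , s≤s (s≤s z≤n)) a∈r
    by-row : Position3 (toℕ a) (val σ i) (val σ j) →
      newPointUnshaded R Fin.zero a σ i j ∧ (toℕ (punchIn a (lookup σ i)) <ᵇ q) ≡ (toℕ (lookup σ i) <ᵇ toℕ a ⊓ q)
    by-row (before a<i) rewrite in-row 0F (strip-before a<i) | sh₀₀ = sym (<ᵇ-⊓-≥ q (≤-pred a<i))
    by-row (inside i≤a a<j) rewrite in-row 1F (strip-inside i≤a a<j) | sh₀₁ | toℕ-punchIn-< a (lookup σ i) i≤a = <ᵇ-⊓-< q i≤a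
    by-row (after j≤a) rewrite in-row 2F (strip-after (≤-pred (toℕ<n a)) j≤a) | sh₀₂
                             | toℕ-punchIn-< a (lookup σ i) (≤-trans (≤-pred vi<vj) (<⇒≤ j≤a)) = <ᵇ-⊓-< q (≤-trans (≤-pred vi<vj) (<⇒≤ j≤a))

occBelow-byFirst : ∀ (R : MeshR) → unshaded R 0F 0F ≡ false → unshaded R 0F 1F ≡ true → unshaded R 0F 2F ≡ true →
  ∀ {n} (a : Fin (suc n)) (σ : Vec (Fin n) n) (t : Fin n) q (B : Bool) →
  (∀ j → isOcc R (insert Fin.zero a σ) Fin.zero (Fin.suc j) ≡ (toℕ j ≡ᵇ toℕ t) ∧ B) →
  occBelow R (insert Fin.zero a σ) (lowerValue (insert Fin.zero a σ)) q ≡ 𝟙 (B ∧ (toℕ a <ᵇ q)) + occBelow R σ (lowerValue σ) (toℕ a ⊓ q)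
occBelow-byFirst R sh₀₀ sh₀₁ sh₀₂ a σ t q B partner =
  trans (occBelow-insert R Fin.zero a σ (lowerValue π) q (lowerValue σ) (toℕ a ⊓ q) (old-pairs-byFirst R sh₀₀ sh₀₁ sh₀₂ a σ q))
    (cong₂ _+_ (∑-unique-partner t B (toℕ a <ᵇ q) (λ j → isOcc R π Fin.zero (Fin.suc j)) partner)
               (cong (_+ occBelow R σ (lowerValue σ) (toℕ a ⊓ q))
                     (∑-no-partner (λ i → isOcc R π (Fin.suc i) Fin.zero) (λ i → lowerValue π (Fin.suc i) Fin.zero <ᵇ q) first-is-not-second)))
  where
  π = insert Fin.zero a σ
  first-is-not-second : ∀ i → isOcc R π (Fin.suc i) Fin.zero ≡ true → ⊥
  first-is-not-second i occurs = <⇒≱ (occ-pos< R π (Fin.suc i) Fin.zero occurs) (s≤s z≤n)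

module FirstTwo {n} (a : Fin (suc (suc n))) (x₂ : Fin (suc n)) (σ′ : Vec (Fin n) n) (inj : Injective σ′) where

  σ = insert Fin.zero x₂ σ′
  π = insert Fin.zero a σ
  σ-injective = insert-injective Fin.zero x₂ σ′ inj
  π-injective = insert-injective Fin.zero a σ σ-injective

  val-1 : val π (# 1) ≡ suc (toℕ (punchIn a x₂))
  val-1 = cong (suc ∘ toℕ) (lookup-insert-punchIn Fin.zero a σ Fin.zero)

  partner-is-second : ∀ (R : MeshR) j → isOcc R π Fin.zero (Fin.suc j) ≡ true → box₁₁ ∈ R → box₁₀ ∈ R → box₁₂ ∈ R → j ≡ Fin.zero
  partner-is-second R j occurs m₁₁ m₁₀ m₁₂ =
    toℕ-injective (suc-injective (suc-injective (occ-positions-consecutive R π Fin.zero (Fin.suc j) π-injective occurs m₁₁ (inj₁ m₁₀) (inj₁ m₁₂))))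

  a≤x₂ : ∀ R → isOcc R π Fin.zero (# 1) ≡ true → toℕ a ≤ toℕ x₂
  a≤x₂ R occurs with <-cmp (toℕ x₂) (toℕ a)
  ... | tri< x₂<a _ _ = ⊥-elim (<-asym x₂<a (subst (toℕ a <_) (toℕ-punchIn-< a x₂ x₂<a)
                          (≤-pred (subst (suc (toℕ a) <_) val-1 (occ-val< R π Fin.zero (# 1) occurs)))))
  ... | tri≈ _ x₂≡a _ = ≤-reflexive (sym x₂≡a)
  ... | tri> _ _ a<x₂ = <⇒≤ a<x₂

  -- A value of σ above x₂ would put a point in the box (2,2) of the occurrence.
  x₂-largest : ∀ R → isOcc R π Fin.zero (# 1) ≡ true → box₂₂ ∈ R → toℕ x₂ ≡ n
  x₂-largest R occurs m₂₂ with toℕ x₂ ≟ n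
  ... | yes x₂≡n = x₂≡n
  ... | no x₂≢n with injective⇒surjective σ σ-injective (fromℕ n)
  ...   | m , σm≡n = ⊥-elim (occ-unshaded R π Fin.zero (# 1) occurs m₂₂ (Fin.suc m)
                       (s≤s (s≤s m≢0)) (s≤s (pos≤n (Fin.suc m))) v1<vm (s≤s (val≤n π (Fin.suc m))))
    where
    m≢0 : 0 < toℕ m
    m≢0 = n≢0⇒n>0 (λ m≡0 → x₂≢n (trans (cong toℕ (subst (λ k → lookup σ k ≡ fromℕ n) (toℕ-injective {j = Fin.zero} m≡0) σm≡n))
                                      (toℕ-fromℕ n)))
    v1<vm : val π (# 1) < val π (Fin.suc m)
    v1<vm = subst₂ _<_ (sym (val-insert-punchIn Fin.zero a σ Fin.zero)) (sym (val-insert-punchIn Fin.zero a σ m))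
              (shift-mono-< (toℕ a) (s≤s (subst (toℕ x₂ <_) (sym (trans (cong toℕ σm≡n) (toℕ-fromℕ n)))
                                                 (≤∧≢⇒< (≤-pred (toℕ<n x₂)) x₂≢n))))

partner-R4 : ∀ {n} (a : Fin (suc (suc n))) (x₂ : Fin (suc n)) (σ′ : Vec (Fin n) n) → Injective σ′ → ∀ j →
  isOcc R4 (insert Fin.zero a (insert Fin.zero x₂ σ′)) Fin.zero (Fin.suc j) ≡ (toℕ j ≡ᵇ toℕ (Fin.zero {n})) ∧ (toℕ a ≡ᵇ toℕ x₂)
partner-R4 {n} a x₂ σ′ inj j = Bool-ext occurrence⇒ ⇒occurrence
  where
  open FirstTwo a x₂ σ′ inj
  occurrence⇒ : isOcc R4 π Fin.zero (Fin.suc j) ≡ true → (toℕ j ≡ᵇ 0) ∧ (toℕ a ≡ᵇ toℕ x₂) ≡ true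
  occurrence⇒ occurs with partner-is-second R4 j occurs (there (here refl)) (there (there (there (there (here refl))))) (here refl)
  ... | refl = ∧-true refl (≡⇒≡ᵇ≡true (sym (suc-injective (trans (sym (toℕ-punchIn-≥ a x₂ (a≤x₂ R4 occurs)))
                                                                  (suc-injective (trans (sym val-1) consecutive))))))
    where
    consecutive = occ-values-consecutive R4 π Fin.zero (# 1) π-injective occurs (there (here refl)) (inj₂ refl) (inj₁ (there (there (here refl))))
  ⇒occurrence : (toℕ j ≡ᵇ 0) ∧ (toℕ a ≡ᵇ toℕ x₂) ≡ true → isOcc R4 π Fin.zero (Fin.suc j) ≡ true
  ⇒occurrence e with toℕ-injective {i = j} {j = Fin.zero} (≡ᵇ≡true⇒≡ (∧-trueˡ e))
  ... | refl = trans (isOccAt-cong R4 π {x₁′ = 1} {x₂′ = 2} {y₁′ = suc (toℕ a)} refl refl refl val-1′)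
                     (isOccAt-true R4 π {1} {2} {suc (toℕ a)} {suc (suc (toℕ a))} (s≤s (s≤s z≤n)) (n<1+n _) boxes)
    where
    a≡x₂ : toℕ a ≡ toℕ x₂
    a≡x₂ = ≡ᵇ≡true⇒≡ (∧-trueʳ (toℕ j ≡ᵇ 0) e)
    val-1′ : val π (# 1) ≡ suc (suc (toℕ a))
    val-1′ = trans val-1 (cong suc (trans (toℕ-punchIn-≥ a x₂ (≤-reflexive a≡x₂)) (cong suc (sym a≡x₂))))
    XS = bounds (suc (suc n)) 1 2
    YS = bounds (suc (suc n)) (suc (toℕ a)) (suc (suc (toℕ a)))
    boxes : allᵇ (boxEmpty π XS YS) R4 ≡ true
    boxes = ∧-true (thin-column-empty π XS YS 1F 2F ≤-refl)
           (∧-true (thin-column-empty π XS YS 1F 1F ≤-refl)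
           (∧-true (thin-row-empty π XS YS 2F 1F ≤-refl)
           (∧-true (thin-column-empty π XS YS 0F 0F ≤-refl)
           (∧-true (thin-column-empty π XS YS 1F 0F ≤-refl) refl))))

occBelow-R4 : ∀ {n} (c : Code n) q → occBelow R4 (decode byFirst c) (lowerValue (decode byFirst c)) q ≡ repeatCount c q
occBelow-R4 {zero} tt q = refl
occBelow-R4 {suc zero} (x , tt) q = occBelow-singleton R4 (decode byFirst (x , tt)) (lowerValue (decode byFirst (x , tt))) q
occBelow-R4 {suc (suc n)} (x₁ , x₂ , c) q =
  trans (occBelow-byFirst R4 refl refl refl x₁ (decode byFirst (x₂ , c)) Fin.zero q (toℕ x₁ ≡ᵇ toℕ x₂)
                          (partner-R4 x₁ x₂ (decode byFirst c) (decode-injective byFirst c)))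
        (cong (𝟙 ((toℕ x₁ ≡ᵇ toℕ x₂) ∧ (toℕ x₁ <ᵇ q)) +_) (occBelow-R4 (x₂ , c) (toℕ x₁ ⊓ q)))

partner-R6 : ∀ {n} (a : Fin (suc (suc n))) (x₂ : Fin (suc n)) (σ′ : Vec (Fin n) n) → Injective σ′ → ∀ j →
  isOcc R6 (insert Fin.zero a (insert Fin.zero x₂ σ′)) Fin.zero (Fin.suc j) ≡ (toℕ j ≡ᵇ toℕ (Fin.zero {n})) ∧ (toℕ x₂ ≡ᵇ n) ∧ (toℕ a ≤ᵇ toℕ x₂)
partner-R6 {n} a x₂ σ′ inj j = Bool-ext occurrence⇒ ⇒occurrence
  where
  open FirstTwo a x₂ σ′ inj
  occurrence⇒ : isOcc R6 π Fin.zero (Fin.suc j) ≡ true → (toℕ j ≡ᵇ 0) ∧ (toℕ x₂ ≡ᵇ n) ∧ (toℕ a ≤ᵇ toℕ x₂) ≡ true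
  occurrence⇒ occurs with partner-is-second R6 j occurs (there (there (here refl))) (there (there (there (there (here refl))))) (here refl)
  ... | refl = ∧-true refl (∧-true (≡⇒≡ᵇ≡true (x₂-largest R6 occurs (there (here refl)))) (≤⇒≤ᵇ≡true (a≤x₂ R6 occurs)))
  ⇒occurrence : (toℕ j ≡ᵇ 0) ∧ (toℕ x₂ ≡ᵇ n) ∧ (toℕ a ≤ᵇ toℕ x₂) ≡ true → isOcc R6 π Fin.zero (Fin.suc j) ≡ true
  ⇒occurrence e with toℕ-injective {i = j} {j = Fin.zero} (≡ᵇ≡true⇒≡ (∧-trueˡ e))
  ... | refl = trans (isOccAt-cong R6 π {x₁′ = 1} {x₂′ = 2} {y₁′ = suc (toℕ a)} refl refl refl val-1′)
                     (isOccAt-true R6 π {1} {2} {suc (toℕ a)} {suc (suc n)} (s≤s (s≤s z≤n)) (s≤s (s≤s (subst (toℕ a ≤_) x₂≡n a≤x₂′))) boxes)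
    where
    x₂≡n : toℕ x₂ ≡ n
    x₂≡n = ≡ᵇ≡true⇒≡ (∧-trueˡ (∧-trueʳ (toℕ j ≡ᵇ 0) e))
    a≤x₂′ : toℕ a ≤ toℕ x₂
    a≤x₂′ = ≤ᵇ≡true⇒≤ (∧-trueʳ (toℕ x₂ ≡ᵇ n) (∧-trueʳ (toℕ j ≡ᵇ 0) e))
    val-1′ : val π (# 1) ≡ suc (suc n)
    val-1′ = trans val-1 (cong suc (trans (toℕ-punchIn-≥ a x₂ a≤x₂′) (cong suc x₂≡n)))
    XS = bounds (suc (suc n)) 1 2
    YS = bounds (suc (suc n)) (suc (toℕ a)) (suc (suc n))
    boxes : allᵇ (boxEmpty π XS YS) R6 ≡ true
    boxes = ∧-true (thin-column-empty π XS YS 1F 2F ≤-refl)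
           (∧-true (thin-row-empty π XS YS 2F 2F ≤-refl)
           (∧-true (thin-column-empty π XS YS 1F 1F ≤-refl)
           (∧-true (thin-column-empty π XS YS 0F 0F ≤-refl)
           (∧-true (thin-column-empty π XS YS 1F 0F ≤-refl) refl))))

occBelow-R6 : ∀ {n} (c : Code n) q → occBelow R6 (decode byFirst c) (lowerValue (decode byFirst c)) q ≡ topCount c q
occBelow-R6 {zero} tt q = refl
occBelow-R6 {suc zero} (x , tt) q = occBelow-singleton R6 (decode byFirst (x , tt)) (lowerValue (decode byFirst (x , tt))) q
occBelow-R6 {suc (suc n)} (x₁ , x₂ , c) q =
  trans (occBelow-byFirst R6 refl refl refl x₁ (decode byFirst (x₂ , c)) Fin.zero q ((toℕ x₂ ≡ᵇ n) ∧ (toℕ x₁ ≤ᵇ toℕ x₂))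
                          (partner-R6 x₁ x₂ (decode byFirst c) (decode-injective byFirst c)))
        (cong₂ _+_ (cong 𝟙 (∧-assoc (toℕ x₂ ≡ᵇ n) (toℕ x₁ ≤ᵇ toℕ x₂) (toℕ x₁ <ᵇ q))) (occBelow-R6 (x₂ , c) (toℕ x₁ ⊓ q)))

-- Removing the maximum: R3

rightGap : ∀ {n} → Fin n → Fin n → ℕ
rightGap {n} i j = n ∸ suc (toℕ j)

old-pairs-byMaximum : ∀ {N} (R : MeshR) → unshaded R 0F 2F ≡ true → unshaded R 1F 2F ≡ true → unshaded R 2F 2F ≡ false →
  ∀ (p : Fin (suc N)) (σ : Vec (Fin N) N) q i j →
  𝟙 (isOcc R (insert p (fromℕ N) σ) (punchIn p i) (punchIn p j) ∧ (rightGap (punchIn p i) (punchIn p j) <ᵇ q))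
    ≡ 𝟙 (isOcc R σ i j ∧ (rightGap i j <ᵇ (N ∸ toℕ p) ⊓ q))
old-pairs-byMaximum {N} R sh₀₂ sh₁₂ sh₂₂ p σ q i j =
  trans (cong (λ t → 𝟙 (t ∧ (rightGap (punchIn p i) (punchIn p j) <ᵇ q))) (isOcc-insert R p (fromℕ N) σ i j)) (𝟙-∧-guarded _ _ _ _ threshold)
  where
  threshold : isOcc R σ i j ≡ true → newPointUnshaded R p (fromℕ N) σ i j ∧ (N ∸ toℕ (punchIn p j) <ᵇ q) ≡ (N ∸ suc (toℕ j) <ᵇ (N ∸ toℕ p) ⊓ q)
  threshold occurs = by-column (position3 (toℕ p) (pos i) (pos j))
    where
    open NewPointStrip N (toℕ p) (pos i) (pos j)
    pi<pj = occ-pos< R σ i j occurs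
    top : InStrip (bounds (suc N) (shift (toℕ (fromℕ N)) (val σ i)) (shift (toℕ (fromℕ N)) (val σ j))) (suc (toℕ (fromℕ N))) 2F
    top rewrite toℕ-fromℕ N | shift-≤ N (val σ j) (val≤n σ j) = s≤s (val≤n σ j) , ≤-refl
    in-column : ∀ c → InStrip zs (pos p) c → newPointUnshaded R p (fromℕ N) σ i j ≡ unshaded R c 2F
    in-column c p∈c = newPointUnshaded≡unshaded R p (fromℕ N) σ i j c 2F pi<pj (occ-val< R σ i j occurs) p∈c top
    by-column : Position3 (toℕ p) (pos i) (pos j) →
      newPointUnshaded R p (fromℕ N) σ i j ∧ (N ∸ toℕ (punchIn p j) <ᵇ q) ≡ (N ∸ suc (toℕ j) <ᵇ (N ∸ toℕ p) ⊓ q)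
    by-column (before p<i) rewrite in-column 0F (strip-before p<i) | sh₀₂ | toℕ-punchIn-≥ p j (≤-pred (≤-trans p<i (<⇒≤ pi<pj))) =
      <ᵇ-⊓-< q (∸-monoʳ-< (≤-trans p<i (<⇒≤ pi<pj)) (toℕ<n j))
    by-column (inside i≤p p<j) rewrite in-column 1F (strip-inside i≤p p<j) | sh₁₂ | toℕ-punchIn-≥ p j (≤-pred p<j) =
      <ᵇ-⊓-< q (∸-monoʳ-< p<j (toℕ<n j))
    by-column (after j≤p) rewrite in-column 2F (strip-after (≤-pred (toℕ<n p)) j≤p) | sh₂₂ = sym (<ᵇ-⊓-≥ q (∸-monoʳ-≤ N j≤p))

occBelow-byMaximum : ∀ (R : MeshR) → unshaded R 0F 2F ≡ true → unshaded R 1F 2F ≡ true → unshaded R 2F 2F ≡ false →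
  ∀ {n} (p : Fin (suc n)) (σ : Vec (Fin n) n) (t : Fin n) q (B : Bool) →
  (∀ i → isOcc R (insert p (fromℕ n) σ) (punchIn p i) p ≡ (toℕ i ≡ᵇ toℕ t) ∧ B) →
  occBelow R (insert p (fromℕ n) σ) rightGap q ≡ 𝟙 (B ∧ ((n ∸ toℕ p) <ᵇ q)) + occBelow R σ rightGap ((n ∸ toℕ p) ⊓ q)
occBelow-byMaximum R sh₀₂ sh₁₂ sh₂₂ {n} p σ t q B partner =
  trans (occBelow-insert R p (fromℕ n) σ rightGap q rightGap ((n ∸ toℕ p) ⊓ q) (old-pairs-byMaximum R sh₀₂ sh₁₂ sh₂₂ p σ q))
    (cong₂ _+_ (∑-no-partner (λ j → isOcc R π p (punchIn p j)) (λ j → rightGap p (punchIn p j) <ᵇ q) maximum-is-not-first)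
               (cong (_+ occBelow R σ rightGap ((n ∸ toℕ p) ⊓ q))
                     (∑-unique-partner t B ((n ∸ toℕ p) <ᵇ q) (λ i → isOcc R π (punchIn p i) p) partner)))
  where
  π = insert p (fromℕ n) σ
  maximum-is-not-first : ∀ j → isOcc R π p (punchIn p j) ≡ true → ⊥
  maximum-is-not-first j occurs = <⇒≱ (occ-val< R π p (punchIn p j) occurs)
    (subst (val π (punchIn p j) ≤_) (sym (cong suc (trans (cong toℕ (lookup-insert p (fromℕ n) σ)) (toℕ-fromℕ n))))
           (val≤n π (punchIn p j)))

module TwoLargest {n} (p : Fin (suc (suc n))) (p₂ : Fin (suc n)) (σ′ : Vec (Fin n) n) (inj : Injective σ′) where

  σ = insert p₂ (fromℕ n) σ′
  π = insert p (fromℕ (suc n)) σ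
  π-injective = insert-injective p (fromℕ (suc n)) σ (insert-injective p₂ (fromℕ n) σ′ inj)

  val-p : val π p ≡ suc (suc n)
  val-p = cong suc (trans (cong toℕ (lookup-insert p (fromℕ (suc n)) σ)) (toℕ-fromℕ (suc n)))

  val-punchIn : ∀ i → val π (punchIn p i) ≡ val σ i
  val-punchIn i = trans (val-insert-punchIn p (fromℕ (suc n)) σ i)
                        (trans (cong (λ c → shift c (val σ i)) (toℕ-fromℕ (suc n))) (shift-≤ (suc n) (val σ i) (val≤n σ i)))

  val-p₂ : val σ p₂ ≡ suc n
  val-p₂ = cong suc (trans (cong toℕ (lookup-insert p₂ (fromℕ n) σ′)) (toℕ-fromℕ n))

  val≡1+n⇒p₂ : ∀ i → val σ i ≡ suc n → i ≡ p₂
  val≡1+n⇒p₂ i e = lookup-insert⁻¹ p₂ (fromℕ n) σ′ i (toℕ-injective (trans (suc-injective e) (sym (toℕ-fromℕ n))))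

  before-p : ∀ i → pos (punchIn p i) < pos p → toℕ i < toℕ p
  before-p i i<p with ≤-<-connex (toℕ p) (toℕ i)
  ... | inj₂ i<p′ = i<p′
  ... | inj₁ p≤i = ⊥-elim (<-irrefl refl (≤-trans (≤-trans (n≤1+n (suc (toℕ i)))
                                           (subst (λ z → suc z ≤ toℕ p) (toℕ-punchIn-≥ p i p≤i) (≤-pred i<p))) p≤i))

partner-R3 : ∀ {n} (p : Fin (suc (suc n))) (p₂ : Fin (suc n)) (σ′ : Vec (Fin n) n) → Injective σ′ → ∀ i →
  isOcc R3 (insert p (fromℕ (suc n)) (insert p₂ (fromℕ n) σ′)) (punchIn p i) p ≡ (toℕ i ≡ᵇ toℕ p₂) ∧ (suc (toℕ p₂) ≡ᵇ toℕ p)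
partner-R3 {n} p p₂ σ′ inj i = Bool-ext occurrence⇒ ⇒occurrence
  where
  open TwoLargest p p₂ σ′ inj
  occurrence⇒ : isOcc R3 π (punchIn p i) p ≡ true → (toℕ i ≡ᵇ toℕ p₂) ∧ (suc (toℕ p₂) ≡ᵇ toℕ p) ≡ true
  occurrence⇒ occurs = ∧-true (≡⇒≡ᵇ≡true (cong toℕ i≡p₂))
    (≡⇒≡ᵇ≡true (sym (trans (suc-injective positions) (cong suc (trans (toℕ-punchIn-< p i (before-p i (occ-pos< R3 π (punchIn p i) p occurs)))
                                                                     (cong toℕ i≡p₂))))))
    where
    values = occ-values-consecutive R3 π (punchIn p i) p π-injective occurs
               (there (there (here refl))) (inj₁ (there (here refl))) (inj₁ (there (there (there (here refl)))))
    i≡p₂ : i ≡ p₂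
    i≡p₂ = val≡1+n⇒p₂ i (suc-injective (trans (sym (cong suc (val-punchIn i))) (trans (sym values) val-p)))
    positions = occ-positions-consecutive R3 π (punchIn p i) p π-injective occurs
                  (there (there (here refl))) (inj₁ (there (there (there (there (here refl)))))) (inj₂ val-p)
  ⇒occurrence : (toℕ i ≡ᵇ toℕ p₂) ∧ (suc (toℕ p₂) ≡ᵇ toℕ p) ≡ true → isOcc R3 π (punchIn p i) p ≡ true
  ⇒occurrence e with toℕ-injective {i = i} {j = p₂} (≡ᵇ≡true⇒≡ (∧-trueˡ e))
  ... | refl = trans (isOccAt-cong R3 π {x₁′ = suc (toℕ i)} {x₂′ = suc (suc (toℕ i))} {y₁′ = suc n} {y₂′ = suc (suc n)}
                        (cong suc (toℕ-punchIn-< p i (≤-reflexive 1+i≡p))) (cong suc (sym 1+i≡p)) (trans (val-punchIn i) val-p₂) val-p)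
                     (isOccAt-true R3 π {suc (toℕ i)} {suc (suc (toℕ i))} {suc n} {suc (suc n)} (n<1+n _) (n<1+n _) boxes)
    where
    1+i≡p : suc (toℕ i) ≡ toℕ p
    1+i≡p = ≡ᵇ≡true⇒≡ (∧-trueʳ (toℕ i ≡ᵇ toℕ i) e)
    XS = bounds (suc (suc n)) (suc (toℕ i)) (suc (suc (toℕ i)))
    YS = bounds (suc (suc n)) (suc n) (suc (suc n))
    boxes : allᵇ (boxEmpty π XS YS) R3 ≡ true
    boxes = ∧-true (thin-row-empty π XS YS 2F 2F ≤-refl)
           (∧-true (thin-row-empty π XS YS 0F 1F ≤-refl)
           (∧-true (thin-row-empty π XS YS 1F 1F ≤-refl)
           (∧-true (thin-row-empty π XS YS 2F 1F ≤-refl)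
           (∧-true (thin-column-empty π XS YS 1F 0F ≤-refl) refl))))

repeat-opposite : ∀ n (x₁ : Fin (suc (suc n))) (x₂ : Fin (suc n)) → (suc (toℕ (opposite x₂)) ≡ᵇ toℕ (opposite x₁)) ≡ (toℕ x₁ ≡ᵇ toℕ x₂)
repeat-opposite n x₁ x₂ rewrite opposite-prop x₁ | opposite-prop x₂ = Bool-ext
  (λ e → ≡⇒≡ᵇ≡true (sym (∸-cancelˡ-≡ (≤-trans x₂≤n (n≤1+n n)) x₁≤1+n (trans (sym 1+[n∸x₂]) (≡ᵇ≡true⇒≡ e)))))
  (λ e → ≡⇒≡ᵇ≡true (trans 1+[n∸x₂] (cong (suc n ∸_) (sym (≡ᵇ≡true⇒≡ {toℕ x₁} {toℕ x₂} e)))))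
  where
  x₂≤n = ≤-pred (toℕ<n x₂)
  x₁≤1+n = ≤-pred (toℕ<n x₁)
  1+[n∸x₂] : suc (n ∸ toℕ x₂) ≡ suc n ∸ toℕ x₂
  1+[n∸x₂] = sym (+-∸-assoc 1 x₂≤n)

gap-opposite : ∀ n (x : Fin (suc (suc n))) → suc n ∸ toℕ (opposite x) ≡ toℕ x
gap-opposite n x rewrite opposite-prop x = m∸[m∸n]≡n (≤-pred (toℕ<n x))

occBelow-R3 : ∀ {n} (c : Code n) q → occBelow R3 (decode byMaximum c) rightGap q ≡ repeatCount c q
occBelow-R3 {zero} tt q = refl
occBelow-R3 {suc zero} (x , tt) q = occBelow-singleton R3 (decode byMaximum (x , tt)) rightGap q
occBelow-R3 {suc (suc n)} (x₁ , x₂ , c) q =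
  trans (occBelow-byMaximum R3 refl refl refl (opposite x₁) (decode byMaximum (x₂ , c)) (opposite x₂) q
                            (suc (toℕ (opposite x₂)) ≡ᵇ toℕ (opposite x₁))
                            (partner-R3 (opposite x₁) (opposite x₂) (decode byMaximum c) (decode-injective byMaximum c)))
        (cong₂ _+_ (cong 𝟙 (cong₂ _∧_ (repeat-opposite n x₁ x₂) (cong (_<ᵇ q) (gap-opposite n x₁))))
                   (trans (cong (λ t → occBelow R3 (decode byMaximum (x₂ , c)) rightGap (t ⊓ q)) (gap-opposite n x₁))
                          (occBelow-R3 (x₂ , c) (toℕ x₁ ⊓ q))))

-- Removing the last entry: R2

upperGap : ∀ {n} → Vec (Fin n) n → Fin n → Fin n → ℕ
upperGap {n} π i j = n ∸ suc (toℕ (lookup π j))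

old-pairs-byLast : ∀ {N} (R : MeshR) → unshaded R 2F 0F ≡ true → unshaded R 2F 1F ≡ true → unshaded R 2F 2F ≡ false →
  ∀ (a : Fin (suc N)) (σ : Vec (Fin N) N) q i j →
  𝟙 (isOcc R (insert (fromℕ N) a σ) (punchIn (fromℕ N) i) (punchIn (fromℕ N) j)
       ∧ (upperGap (insert (fromℕ N) a σ) (punchIn (fromℕ N) i) (punchIn (fromℕ N) j) <ᵇ q))
    ≡ 𝟙 (isOcc R σ i j ∧ (upperGap σ i j <ᵇ (N ∸ toℕ a) ⊓ q))
old-pairs-byLast {N} R sh₂₀ sh₂₁ sh₂₂ a σ q i j =
  trans (cong (λ t → 𝟙 (t ∧ (upperGap π (punchIn p i) (punchIn p j) <ᵇ q))) (isOcc-insert R p a σ i j)) (𝟙-∧-guarded _ _ _ _ threshold)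
  where
  p = fromℕ N
  π = insert p a σ
  threshold : isOcc R σ i j ≡ true →
    newPointUnshaded R p a σ i j ∧ (upperGap π (punchIn p i) (punchIn p j) <ᵇ q) ≡ (upperGap σ i j <ᵇ (N ∸ toℕ a) ⊓ q)
  threshold occurs rewrite lookup-insert-punchIn p a σ j = by-row (position3 (toℕ a) (val σ i) (val σ j))
    where
    open NewPointStrip N (toℕ a) (val σ i) (val σ j)
    vi<vj = occ-val< R σ i j occurs
    last : InStrip (bounds (suc N) (shift (toℕ p) (pos i)) (shift (toℕ p) (pos j))) (pos p) 2F
    last rewrite toℕ-fromℕ N | shift-≤ N (pos j) (pos≤n j) = s≤s (pos≤n j) , ≤-refl
    in-row : ∀ r → InStrip zs (suc (toℕ a)) r → newPointUnshaded R p a σ i j ≡ unshaded R 2F r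
    in-row r a∈r = newPointUnshaded≡unshaded R p a σ i j 2F r (occ-pos< R σ i j occurs) vi<vj last a∈r
    by-row : Position3 (toℕ a) (val σ i) (val σ j) →
      newPointUnshaded R p a σ i j ∧ (N ∸ toℕ (punchIn a (lookup σ j)) <ᵇ q) ≡ (N ∸ suc (toℕ (lookup σ j)) <ᵇ (N ∸ toℕ a) ⊓ q)
    by-row (before a<i) rewrite in-row 0F (strip-before a<i) | sh₂₀ | toℕ-punchIn-≥ a (lookup σ j) (≤-pred (≤-trans a<i (<⇒≤ vi<vj))) =
      <ᵇ-⊓-< q (∸-monoʳ-< (≤-trans a<i (<⇒≤ vi<vj)) (toℕ<n (lookup σ j)))
    by-row (inside i≤a a<j) rewrite in-row 1F (strip-inside i≤a a<j) | sh₂₁ | toℕ-punchIn-≥ a (lookup σ j) (≤-pred a<j) =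
      <ᵇ-⊓-< q (∸-monoʳ-< a<j (toℕ<n (lookup σ j)))
    by-row (after j≤a) rewrite in-row 2F (strip-after (≤-pred (toℕ<n a)) j≤a) | sh₂₂ = sym (<ᵇ-⊓-≥ q (∸-monoʳ-≤ N j≤a))

occBelow-byLast : ∀ (R : MeshR) → unshaded R 2F 0F ≡ true → unshaded R 2F 1F ≡ true → unshaded R 2F 2F ≡ false →
  ∀ {n} (a : Fin (suc n)) (σ : Vec (Fin n) n) (t : Fin n) q (B : Bool) →
  (∀ i → isOcc R (insert (fromℕ n) a σ) (punchIn (fromℕ n) i) (fromℕ n) ≡ (toℕ i ≡ᵇ toℕ t) ∧ B) →
  occBelow R (insert (fromℕ n) a σ) (upperGap (insert (fromℕ n) a σ)) q ≡ 𝟙 (B ∧ ((n ∸ toℕ a) <ᵇ q)) + occBelow R σ (upperGap σ) ((n ∸ toℕ a) ⊓ q)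
occBelow-byLast R sh₂₀ sh₂₁ sh₂₂ {n} a σ t q B partner =
  trans (occBelow-insert R p a σ (upperGap π) q (upperGap σ) ((n ∸ toℕ a) ⊓ q) (old-pairs-byLast R sh₂₀ sh₂₁ sh₂₂ a σ q))
    (cong₂ _+_ (∑-no-partner (λ j → isOcc R π p (punchIn p j)) (λ j → upperGap π p (punchIn p j) <ᵇ q) last-is-not-first)
               (cong (_+ occBelow R σ (upperGap σ) ((n ∸ toℕ a) ⊓ q))
                 (trans (sum-cong-≗ (λ i → cong (λ z → 𝟙 (isOcc R π (punchIn p i) p ∧ ((n ∸ toℕ z) <ᵇ q))) (lookup-insert p a σ)))
                        (∑-unique-partner t B ((n ∸ toℕ a) <ᵇ q) (λ i → isOcc R π (punchIn p i) p) partner))))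
  where
  p = fromℕ n
  π = insert p a σ
  last-is-not-first : ∀ j → isOcc R π p (punchIn p j) ≡ true → ⊥
  last-is-not-first j occurs = <⇒≱ (occ-pos< R π p (punchIn p j) occurs)
    (subst (λ z → pos (punchIn p j) ≤ suc z) (sym (toℕ-fromℕ n)) (pos≤n (punchIn p j)))

module LastTwo {n} (a : Fin (suc (suc n))) (a₂ : Fin (suc n)) (σ′ : Vec (Fin n) n) (inj : Injective σ′) where

  p = fromℕ (suc n)
  σ = insert (fromℕ n) a₂ σ′
  π = insert p a σ
  π-injective = insert-injective p a σ (insert-injective (fromℕ n) a₂ σ′ inj)

  pos-p : pos p ≡ suc (suc n)
  pos-p = cong suc (toℕ-fromℕ (suc n))

  toℕ-punchIn-p : ∀ i → toℕ (punchIn p i) ≡ toℕ i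
  toℕ-punchIn-p i = toℕ-punchIn-< p i (subst (toℕ i <_) (sym (toℕ-fromℕ (suc n))) (toℕ<n i))

  val-p : val π p ≡ suc (toℕ a)
  val-p = cong (suc ∘ toℕ) (lookup-insert p a σ)

  val-n : val π (punchIn p (fromℕ n)) ≡ suc (toℕ (punchIn a a₂))
  val-n = cong (suc ∘ toℕ) (trans (lookup-insert-punchIn p a σ (fromℕ n)) (cong (punchIn a) (lookup-insert (fromℕ n) a₂ σ′)))

  a≡1+a₂ : toℕ a ≡ suc (toℕ (punchIn a a₂)) → toℕ a ≡ suc (toℕ a₂)
  a≡1+a₂ e with ≤-<-connex (toℕ a) (toℕ a₂)
  ... | inj₁ a≤a₂ = ⊥-elim (<-irrefl refl (≤-trans (≤-trans (n≤1+n _) (≤-reflexive (sym (trans e (cong suc (toℕ-punchIn-≥ a a₂ a≤a₂)))))) a≤a₂))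
  ... | inj₂ a₂<a = trans e (cong suc (toℕ-punchIn-< a a₂ a₂<a))

partner-R2 : ∀ {n} (a : Fin (suc (suc n))) (a₂ : Fin (suc n)) (σ′ : Vec (Fin n) n) → Injective σ′ → ∀ i →
  isOcc R2 (insert (fromℕ (suc n)) a (insert (fromℕ n) a₂ σ′)) (punchIn (fromℕ (suc n)) i) (fromℕ (suc n))
    ≡ (toℕ i ≡ᵇ toℕ (fromℕ n)) ∧ (suc (toℕ a₂) ≡ᵇ toℕ a)
partner-R2 {n} a a₂ σ′ inj i = Bool-ext occurrence⇒ ⇒occurrence
  where
  open LastTwo a a₂ σ′ inj
  occurrence⇒ : isOcc R2 π (punchIn p i) p ≡ true → (toℕ i ≡ᵇ toℕ (fromℕ n)) ∧ (suc (toℕ a₂) ≡ᵇ toℕ a) ≡ true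
  occurrence⇒ occurs = ∧-true (≡⇒≡ᵇ≡true (cong toℕ i≡n)) (≡⇒≡ᵇ≡true (sym (a≡1+a₂ (suc-injective (begin
      suc (toℕ a)                    ≡⟨ val-p ⟨
      val π p                        ≡⟨ values ⟩
      suc (val π (punchIn p i))      ≡⟨ cong (suc ∘ val π ∘ punchIn p) i≡n ⟩
      suc (val π (punchIn p (fromℕ n))) ≡⟨ cong suc val-n ⟩
      suc (suc (toℕ (punchIn a a₂))) ∎)))))
    where
    open ≡-Reasoning
    positions = occ-positions-consecutive R2 π (punchIn p i) p π-injective occurs
                  (there (there (there (here refl)))) (inj₁ (there (there (there (there (here refl)))))) (inj₁ (here refl))
    i≡n : i ≡ fromℕ n
    i≡n = toℕ-injective (trans (sym (toℕ-punchIn-p i)) (trans (suc-injective (suc-injective (trans (sym positions) pos-p)))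
                                                              (sym (toℕ-fromℕ n))))
    values = occ-values-consecutive R2 π (punchIn p i) p π-injective occurs
               (there (there (there (here refl)))) (inj₁ (there (there (here refl)))) (inj₂ pos-p)
  ⇒occurrence : (toℕ i ≡ᵇ toℕ (fromℕ n)) ∧ (suc (toℕ a₂) ≡ᵇ toℕ a) ≡ true → isOcc R2 π (punchIn p i) p ≡ true
  ⇒occurrence e with toℕ-injective {i = i} {j = fromℕ n} (≡ᵇ≡true⇒≡ (∧-trueˡ e))
  ... | refl = trans (isOccAt-cong R2 π {x₁′ = suc n} {x₂′ = suc (suc n)} {y₁′ = toℕ a} {y₂′ = suc (toℕ a)}
                        (cong suc (trans (toℕ-punchIn-p i) (toℕ-fromℕ n))) pos-p val-n′ val-p)
                     (isOccAt-true R2 π {suc n} {suc (suc n)} {toℕ a} {suc (toℕ a)} ≤-refl ≤-refl boxes)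
    where
    1+a₂≡a : suc (toℕ a₂) ≡ toℕ a
    1+a₂≡a = ≡ᵇ≡true⇒≡ (∧-trueʳ (toℕ (fromℕ n) ≡ᵇ toℕ (fromℕ n)) e)
    val-n′ : val π (punchIn p (fromℕ n)) ≡ toℕ a
    val-n′ = trans val-n (trans (cong suc (toℕ-punchIn-< a a₂ (≤-reflexive 1+a₂≡a))) 1+a₂≡a)
    XS = bounds (suc (suc n)) (suc n) (suc (suc n))
    YS = bounds (suc (suc n)) (toℕ a) (suc (toℕ a))
    boxes : allᵇ (boxEmpty π XS YS) R2 ≡ true
    boxes = ∧-true (thin-column-empty π XS YS 1F 2F ≤-refl)
           (∧-true (thin-column-empty π XS YS 2F 2F ≤-refl)
           (∧-true (thin-row-empty π XS YS 0F 1F ≤-refl)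
           (∧-true (thin-column-empty π XS YS 1F 1F ≤-refl)
           (∧-true (thin-column-empty π XS YS 1F 0F ≤-refl) refl))))

occBelow-R2 : ∀ {n} (c : Code n) q → occBelow R2 (decode byLast c) (upperGap (decode byLast c)) q ≡ repeatCount c q
occBelow-R2 {zero} tt q = refl
occBelow-R2 {suc zero} (x , tt) q = occBelow-singleton R2 (decode byLast (x , tt)) (upperGap (decode byLast (x , tt))) q
occBelow-R2 {suc (suc n)} (x₁ , x₂ , c) q =
  trans (occBelow-byLast R2 refl refl refl (opposite x₁) (decode byLast (x₂ , c)) (fromℕ n) q
                         (suc (toℕ (opposite x₂)) ≡ᵇ toℕ (opposite x₁))
                         (partner-R2 (opposite x₁) (opposite x₂) (decode byLast c) (decode-injective byLast c)))
        (cong₂ _+_ (cong 𝟙 (cong₂ _∧_ (repeat-opposite n x₁ x₂) (cong (_<ᵇ q) (gap-opposite n x₁))))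
                   (trans (cong (λ t → occBelow R2 (decode byLast (x₂ , c)) (upperGap (decode byLast (x₂ , c))) (t ⊓ q)) (gap-opposite n x₁))
                          (occBelow-R2 (x₂ , c) (toℕ x₁ ⊓ q))))

s≡distribution : ∀ (D : Decomposition) R (stat : ∀ {n} → Code n → ℕ → ℕ) → (∀ {n} (c : Code n) → occ R (decode D c) ≡ stat c n) →
  ∀ n k → s R n k ≡ ∑[ c ∈ codes n ] 𝟙 (stat c n ≡ᵇ k)
s≡distribution D R stat occ≡stat n k =
  trans (s≡sumCodes D R n k) (sumL-cong (codes n) (λ c → cong (λ t → 𝟙 (t ≡ᵇ k)) (occ≡stat c)))

gap<n : ∀ {n} (k : Fin n) → n ∸ suc (toℕ k) < n
gap<n {suc m} k = s≤s (m∸n≤m m (toℕ k))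

s≡repeatDistribution : ∀ {R} → R ∈ theRs → ∀ n k → s R n k ≡ ∑[ c ∈ codes n ] 𝟙 (repeatCount c n ≡ᵇ k)
s≡repeatDistribution (here refl) = s≡distribution byMinimum R1 repeatCount
  (λ c → trans (occ≡occBelow R1 (decode byMinimum c) leftPosition _ (λ i j → toℕ<n i)) (occBelow-R1 c _))
s≡repeatDistribution (there (here refl)) = s≡distribution byLast R2 repeatCount
  (λ c → trans (occ≡occBelow R2 (decode byLast c) (upperGap (decode byLast c)) _ (λ i j → gap<n (lookup (decode byLast c) j))) (occBelow-R2 c _))
s≡repeatDistribution (there (there (here refl))) = s≡distribution byMaximum R3 repeatCount
  (λ c → trans (occ≡occBelow R3 (decode byMaximum c) rightGap _ (λ i j → gap<n j)) (occBelow-R3 c _))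
s≡repeatDistribution (there (there (there (here refl)))) = s≡distribution byFirst R4 repeatCount
  (λ c → trans (occ≡occBelow R4 (decode byFirst c) (lowerValue (decode byFirst c)) _ (λ i j → toℕ<n (lookup (decode byFirst c) i))) (occBelow-R4 c _))
s≡repeatDistribution (there (there (there (there (here refl))))) n k = trans
  (s≡distribution byMinimum R5 topCount (λ c → trans (occ≡occBelow R5 (decode byMinimum c) leftPosition _ (λ i j → toℕ<n i)) (occBelow-R5 c _)) n k)
  (sym (repeatCount-topCount-equidistributed n k))
s≡repeatDistribution (there (there (there (there (there (here refl)))))) n k = trans
  (s≡distribution byFirst R6 topCount
    (λ c → trans (occ≡occBelow R6 (decode byFirst c) (lowerValue (decode byFirst c)) _ (λ i j → toℕ<n (lookup (decode byFirst c) i))) (occBelow-R6 c _)) n k)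
  (sym (repeatCount-topCount-equidistributed n k))

theorem6p1 : ∀ {R R′ : MeshR} → R ∈ theRs → R′ ∈ theRs → Equidistributed R R′
theorem6p1 R∈ R′∈ n k = trans (s≡repeatDistribution R∈ n k) (sym (s≡repeatDistribution R′∈ n k))
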